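{- Let $\mathcal{A}$ be a simple arrangement of pseudolines $L_0,\dots,L_{n-1}$ in the affine plane with $\mathrm{O}$-matrix $\mathrm{O}$. Let $(L_{i_1},\dots,L_{i_k})$ be a cyclically ordered list of distinct pseudolines of $\mathcal{A}$, and set $i_0=i_k$, $i_{k+1}=i_1$. Then these pseudolines bound a bounded $k$-gonal face of $\mathcal{A}$ (with sides on $L_{i_1},\dots,L_{i_k}$ in this cyclic order) if and only if, for every $s=1,\dots,k$, the two labels $i_{s-1}$ and $i_{s+1}$ appear in adjacent positions (in either order) in the row $\mathrm{O}[i_s]$ of the $\mathrm{O}$-matrix.
   Context: A pseudoline arrangement is a family of curves in the plane, each pair crossing exactly once; it is simple if no point lies on more than two of them. The $\mathrm{O}$-matrix (order matrix) of a simple affine arrangement of $n$ (pseudo)lines is defined as follows. Choose a generic directed sweep line $\gamma$ not parallel to any line of the arrangement, whose initial position is far from all intersection points; label the (pseudo)lines $L_0,\dots,L_{n-1}$ (or $0,\dots,n-1$) in the order in which $\gamma$ meets them in its initial position. As $\gamma$ sweeps through the plane, each intersection point $L_i\cap L_j$ is encountered exactly once; at that moment append $j$ to row $i$ and $i$ to row $j$. The result is an $n\times(n-1)$ matrix whose row $\mathrm{O}[i]$ lists the labels of the other (pseudo)lines in the order in which their crossings with $L_i$ occur along $L_i$. -}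

module Defs where

-- Combinatorial model of a simple affine pseudoline arrangement together with
-- a sweep: a wiring diagram.  The n pseudolines are the wires, labelled
-- 0,…,n-1 by their (bottom-to-top) order on the initial position of the sweep.
-- The sweep encounters the crossings one at a time; the t-th crossing
-- (t = 0,1,…) is recorded by the position p = w[t] at which it happens: the
-- wires currently at positions p and p+1 cross (and swap positions).

open import Data.Nat using (ℕ; zero; suc; _+_; _∸_; _<_; _≡ᵇ_)
open import Data.Bool using (Bool; true; false; _∧_; _∨_; if_then_else_)
open import Data.List using (List; []; _∷_; _++_; map; filter; foldl; take; drop; length; upTo; reverse; [_])
open import Data.List.Relation.Unary.All using (All)
open import Data.Product using (_×_; _,_; Σ; ∃; ∃-syntax)
open import Data.Sum using (_⊎_)
open import Relation.Binary.PropositionalEquality using (_≡_; _≢_)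
open import Relation.Nullary.Decidable using (T?)
open import Data.Bool using (T)

at : List ℕ → ℕ → ℕ
at []       _       = 0
at (x ∷ xs) zero    = x
at (x ∷ xs) (suc i) = at xs i

swapAt : ℕ → List ℕ → List ℕ
swapAt zero    (a ∷ b ∷ xs) = b ∷ a ∷ xs
swapAt (suc p) (x ∷ xs)     = x ∷ swapAt p xs
swapAt _       xs           = xs

stateAt : ℕ → List ℕ → ℕ → List ℕ
stateAt n w t = foldl (λ s p → swapAt p s) (upTo n) (take t w)

crossingAt : ℕ → List ℕ → ℕ → ℕ × ℕ
crossingAt n w t = at (stateAt n w t) (at w t) , at (stateAt n w t) (suc (at w t))

crossings : ℕ → List ℕ → List (ℕ × ℕ)
crossings n w = map (crossingAt n w) (upTo (length w))

involves : ℕ → ℕ × ℕ → Bool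
involves i (a , b) = (a ≡ᵇ i) ∨ (b ≡ᵇ i)

isPair : ℕ → ℕ → ℕ × ℕ → Bool
isPair i j (a , b) = ((a ≡ᵇ i) ∧ (b ≡ᵇ j)) ∨ ((a ≡ᵇ j) ∧ (b ≡ᵇ i))

count : (ℕ × ℕ → Bool) → List (ℕ × ℕ) → ℕ
count f []       = 0
count f (x ∷ xs) = if f x then suc (count f xs) else count f xs

IsArrangement : ℕ → List ℕ → Set
IsArrangement n w =
  All (λ p → suc p < n) w ×
  (∀ i j → i < n → j < n → i ≢ j → count (isPair i j) (crossings n w) ≡ 1)

-- The O-matrix: row i lists the other pseudolines in the order in which the
-- sweep meets their crossings with L_i.
other : ℕ → ℕ × ℕ → ℕ
other i (a , b) = if a ≡ᵇ i then b else a

O : ℕ → List ℕ → ℕ → List ℕ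
O n w i = map (other i) (filter (λ c → T? (involves i c)) (crossings n w))

-- Bounded faces of the wiring diagram: the region between positions p and
-- p+1 between two consecutive crossings t1 < t2 at position p.
IsBoundedFace : ℕ → List ℕ → ℕ → ℕ → Set
IsBoundedFace n w t1 t2 =
  t1 < t2 × t2 < length w × at w t1 ≡ at w t2 ×
  (∀ t → t1 < t → t < t2 → at w t ≢ at w t1)

between : ℕ → ℕ → List ℕ
between t1 t2 = map (λ i → suc t1 + i) (upTo (t2 ∸ suc t1))

-- lower boundary of the face (left to right): pseudolines occupying
-- position p; it changes at each crossing at position p-1.
lowerChain : ℕ → List ℕ → ℕ → ℕ → List ℕ
lowerChain n w t1 t2 =
  at (stateAt n w (suc t1)) (at w t1) ∷
  map (λ t → at (stateAt n w (suc t)) (at w t1))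
      (filter (λ t → T? (suc (at w t) ≡ᵇ at w t1)) (between t1 t2))

-- upper boundary of the face (left to right): pseudolines occupying
-- position p+1; it changes at each crossing at position p+1.
upperChain : ℕ → List ℕ → ℕ → ℕ → List ℕ
upperChain n w t1 t2 =
  at (stateAt n w (suc t1)) (suc (at w t1)) ∷
  map (λ t → at (stateAt n w (suc t)) (suc (at w t1)))
      (filter (λ t → T? (at w t ≡ᵇ suc (at w t1))) (between t1 t2))

-- the supporting pseudolines of the sides of the face, in cyclic
-- (counterclockwise) order
boundary : ℕ → List ℕ → ℕ → ℕ → List ℕ
boundary n w t1 t2 = lowerChain n w t1 t2 ++ reverse (upperChain n w t1 t2)

rotate : ℕ → List ℕ → List ℕ
rotate r xs = drop r xs ++ take r xs

BoundsFace : ℕ → List ℕ → List ℕ → Set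
BoundsFace n w is =
  ∃[ t1 ] ∃[ t2 ] (IsBoundedFace n w t1 t2 ×
    ∃[ r ] (rotate r (boundary n w t1 t2) ≡ is ⊎
            rotate r (reverse (boundary n w t1 t2)) ≡ is))

AdjacentIn : List ℕ → ℕ → ℕ → Set
AdjacentIn row a b =
  ∃[ xs ] ∃[ ys ] (row ≡ xs ++ a ∷ b ∷ ys ⊎ row ≡ xs ++ b ∷ a ∷ ys)

windows3 : List ℕ → List (ℕ × ℕ × ℕ)
windows3 (a ∷ b ∷ c ∷ xs) = (a , b , c) ∷ windows3 (b ∷ c ∷ xs)
windows3 _                = []

lastOr : ℕ → List ℕ → ℕ
lastOr d []       = d
lastOr d (x ∷ xs) = lastOr x xs

-- for (i_1,…,i_k): the triples (i_{s-1}, i_s, i_{s+1}), s = 1..k,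
-- with i_0 = i_k and i_{k+1} = i_1
cyclicTriples : List ℕ → List (ℕ × ℕ × ℕ)
cyclicTriples []       = []
cyclicTriples (x ∷ xs) = windows3 (lastOr x xs ∷ x ∷ xs ++ [ x ])

{-# OPTIONS --safe #-}
module Submission where

-- A simple arrangement is modelled by its wiring diagram: after t crossings the sweep
-- sees the lines in the order state t, and the t-th crossing swaps the lines at
-- positions W t and W t + 1.  A bounded face lies between positions p and p + 1, from
-- a crossing at position p to the next one.
--
-- (⇒) The lines bounding the face from below are those that successively occupy
-- position p; each enters by crossing its predecessor, leaves by crossing its
-- successor and crosses nothing in between.  So these two crossings are consecutive
-- along it: its two neighbours on the boundary are adjacent in its row of O.  The
-- upper boundary (position p + 1) is symmetric.
--
-- (⇐) Adjacency in the rows says that along each line of the cycle the crossings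
-- with its two cyclic neighbours are consecutive.  Start at the earliest of these K
-- vertices, at position p, and walk along the cycle in both directions.  The cycle
-- stays on one side of each of its lines, so the lines met in one direction take
-- turns at position p, each entering from below, and those met in the other direction
-- take turns at position p + 1, until the first later crossing at position p, where
-- the two walks meet.  This closes a bounded face whose sides are exactly the lines
-- of the cycle, in cyclic order.

open import Defs
open import Data.Bool using (Bool; true; false; _∧_; _∨_; if_then_else_)
open import Data.Bool.Properties using (∨-zeroʳ)
open import Data.Empty
open import Data.List using (List; []; _∷_; _++_; map; filter; foldl; take; drop; length; upTo; reverse; [_]; applyUpTo)
open import Data.List.Properties
open import Data.List.Relation.Unary.All using (All; []; _∷_)
open import Data.List.Relation.Unary.AllPairs using ([]; _∷_)
open import Data.List.Relation.Unary.Unique.Propositional using (Unique)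
open import Data.Nat
open import Data.Nat.DivMod using (_/_; _%_; m≡m%n+[m/n]*n; m%n<n; [m+kn]%n≡m%n; m<n⇒m%n≡m; [m+n]%n≡m%n; %-distribˡ-+; n%n≡0; m%n%n≡m%n)
open import Data.Nat.Properties
open import Data.Nat.Solver using (module +-*-Solver)
open +-*-Solver using (solve; _:+_; _:*_; _:=_; con)
open import Data.Product using (Σ; ∃; ∃-syntax; _×_; _,_; proj₁; proj₂)
open import Data.Sum using (_⊎_; inj₁; inj₂)
open import Function.Bundles using (_⇔_; mk⇔)
open import Relation.Binary.Definitions using (tri<; tri≈; tri>)
open import Relation.Binary.PropositionalEquality hiding ([_])
open ≡-Reasoning
open import Relation.Nullary
open import Relation.Nullary.Decidable using (T?)

≡⇒≡ᵇ≡true : ∀ m n → m ≡ n → (m ≡ᵇ n) ≡ true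
≡⇒≡ᵇ≡true zero zero refl = refl
≡⇒≡ᵇ≡true (suc m) (suc m) refl = ≡⇒≡ᵇ≡true m m refl

≡ᵇ≡true⇒≡ : ∀ m n → (m ≡ᵇ n) ≡ true → m ≡ n
≡ᵇ≡true⇒≡ zero zero _ = refl
≡ᵇ≡true⇒≡ (suc m) (suc n) e = cong suc (≡ᵇ≡true⇒≡ m n e)

-- Lists, ranges and filters

false≢true : false ≢ true
false≢true ()

≢⇒≡ᵇ≡false : ∀ m n → m ≢ n → (m ≡ᵇ n) ≡ false
≢⇒≡ᵇ≡false m n ne with m ≡ᵇ n in e
... | true = ⊥-elim (ne (≡ᵇ≡true⇒≡ m n e))
... | false = refl

at-++ˡ : ∀ xs ys i → i < length xs → at (xs ++ ys) i ≡ at xs i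
at-++ˡ (x ∷ xs) ys zero _ = refl
at-++ˡ (x ∷ xs) ys (suc i) (s≤s h) = at-++ˡ xs ys i h

at-++ʳ : ∀ xs ys i → at (xs ++ ys) (length xs + i) ≡ at ys i
at-++ʳ [] ys i = refl
at-++ʳ (x ∷ xs) ys i = at-++ʳ xs ys i

at-applyUpTo : ∀ (f : ℕ → ℕ) N i → i < N → at (applyUpTo f N) i ≡ f i
at-applyUpTo f (suc N) zero _ = refl
at-applyUpTo f (suc N) (suc i) (s≤s h) = at-applyUpTo (λ x → f (suc x)) N i h

at-map : ∀ (f : ℕ → ℕ) xs i → i < length xs → at (map f xs) i ≡ f (at xs i)
at-map f (x ∷ xs) zero _ = refl
at-map f (x ∷ xs) (suc i) (s≤s h) = at-map f xs i h

at-reverse : ∀ xs i → i < length xs → at (reverse xs) i ≡ at xs (length xs ∸ suc i)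
at-reverse (x ∷ xs) i h rewrite unfold-reverse x xs with <-cmp i (length xs)
... | tri< lt _ _ = begin
      at (reverse xs ++ [ x ]) i ≡⟨ at-++ˡ (reverse xs) [ x ] i (subst (i <_) (sym (length-reverse xs)) lt) ⟩
      at (reverse xs) i ≡⟨ at-reverse xs i lt ⟩
      at xs (length xs ∸ suc i) ≡⟨⟩
      at (x ∷ xs) (suc (length xs ∸ suc i)) ≡⟨ cong (at (x ∷ xs)) (sym (+-∸-assoc 1 lt)) ⟩
      at (x ∷ xs) (length xs ∸ i) ∎
... | tri≈ _ refl _ = begin
      at (reverse xs ++ [ x ]) (length xs) ≡⟨ cong (at (reverse xs ++ [ x ])) (sym (trans (+-identityʳ _) (length-reverse xs))) ⟩
      at (reverse xs ++ [ x ]) (length (reverse xs) + 0) ≡⟨ at-++ʳ (reverse xs) [ x ] 0 ⟩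
      x ≡⟨ cong (at (x ∷ xs)) (sym (n∸n≡0 (length xs))) ⟩
      at (x ∷ xs) (length xs ∸ length xs) ∎
... | tri> _ _ gt = ⊥-elim (<-irrefl refl (≤-trans h gt))

at-reverse-≡ : ∀ xs k a i → length xs ≡ k + (a + suc i) → at (reverse xs) i ≡ at xs (k + a)
at-reverse-≡ xs k a i e = trans (at-reverse xs i i<) (cong (at xs) (begin
  length xs ∸ suc i           ≡⟨ cong (_∸ suc i) (trans e (sym (+-assoc k a (suc i)))) ⟩
  (k + a) + suc i ∸ suc i     ≡⟨ m+n∸n≡m (k + a) (suc i) ⟩
  k + a                       ∎))
  where
  i< : i < length xs
  i< = subst (suc i ≤_) (trans (+-assoc k a (suc i)) (sym e)) (m≤n+m (suc i) (k + a))

at-ext : ∀ xs ys → length xs ≡ length ys → (∀ i → i < length xs → at xs i ≡ at ys i) → xs ≡ ys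
at-ext [] [] _ _ = refl
at-ext (x ∷ xs) (y ∷ ys) e h = cong₂ _∷_ (h 0 (s≤s z≤n)) (at-ext xs ys (suc-injective e) (λ i hi → h (suc i) (s≤s hi)))
at-ext [] (y ∷ ys) () _
at-ext (x ∷ xs) [] () _

at-drop : ∀ (xs : List ℕ) r j → at (drop r xs) j ≡ at xs (r + j)
at-drop [] zero j = refl
at-drop [] (suc r) j = refl
at-drop (x ∷ xs) zero j = refl
at-drop (x ∷ xs) (suc r) j = at-drop xs r j

at-take : ∀ (xs : List ℕ) r j → j < r → at (take r xs) j ≡ at xs j
at-take [] (suc r) j h = refl
at-take (x ∷ xs) (suc r) zero h = refl
at-take (x ∷ xs) (suc r) (suc j) (s≤s h) = at-take xs r j h

All-at : ∀ {P : ℕ → Set} xs i → All P xs → i < length xs → P (at xs i)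
All-at (x ∷ xs) zero (px ∷ _) _ = px
All-at (x ∷ xs) (suc i) (_ ∷ pxs) (s≤s h) = All-at xs i pxs h

unique-at : ∀ xs u v → Unique xs → u < length xs → v < length xs → at xs u ≡ at xs v → u ≡ v
unique-at (x ∷ xs) zero zero _ _ _ _ = refl
unique-at (x ∷ xs) zero (suc v) (px ∷ _) _ (s≤s hv) e = ⊥-elim (All-at {P = λ y → ¬ x ≡ y} xs v px hv e)
unique-at (x ∷ xs) (suc u) zero (px ∷ _) (s≤s hu) _ e = ⊥-elim (All-at {P = λ y → ¬ x ≡ y} xs u px hu (sym e))
unique-at (x ∷ xs) (suc u) (suc v) (_ ∷ pu) (s≤s hu) (s≤s hv) e = cong suc (unique-at xs u v pu hu hv e)

drop-length-++ : ∀ (xs ys : List ℕ) → drop (length xs) (xs ++ ys) ≡ ys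
drop-length-++ [] ys = refl
drop-length-++ (x ∷ xs) ys = drop-length-++ xs ys

take-length-++ : ∀ (xs ys : List ℕ) → take (length xs) (xs ++ ys) ≡ xs
take-length-++ [] ys = refl
take-length-++ (x ∷ xs) ys = cong (x ∷_) (take-length-++ xs ys)

rotate-inverse : ∀ (xs : List ℕ) r → rotate (length (drop r xs)) (rotate r xs) ≡ xs
rotate-inverse xs r = trans (cong₂ _++_ (drop-length-++ (drop r xs) (take r xs)) (take-length-++ (drop r xs) (take r xs))) (take++drop≡id r xs)

length-rotate : ∀ (xs : List ℕ) r → length (rotate r xs) ≡ length xs
length-rotate xs r = begin
  length (drop r xs ++ take r xs)         ≡⟨ length-++ (drop r xs) ⟩
  length (drop r xs) + length (take r xs) ≡⟨ +-comm (length (drop r xs)) _ ⟩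
  length (take r xs) + length (drop r xs) ≡⟨ sym (length-++ (take r xs)) ⟩
  length (take r xs ++ drop r xs)         ≡⟨ cong length (take++drop≡id r xs) ⟩
  length xs                               ∎

at-rotate : ∀ xs K r → length xs ≡ suc K → r ≤ suc K → ∀ i → i < suc K → at (rotate r xs) i ≡ at xs ((r + i) % suc K)
at-rotate xs K r hl hr i hi with i <? suc K ∸ r
... | yes lt = trans (at-++ˡ (drop r xs) (take r xs) i (subst (i <_) (sym ld) lt))
                 (trans (at-drop xs r i) (cong (at xs) (sym (m<n⇒m%n≡m small))))
  where
  ld : length (drop r xs) ≡ suc K ∸ r
  ld = trans (length-drop r xs) (cong (_∸ r) hl)
  small : r + i < suc K
  small = subst (r + i <_) (m+[n∸m]≡n hr) (+-monoʳ-< r lt)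
... | no ge = trans (cong (at (rotate r xs)) (sym ei))
               (trans (at-++ʳ (drop r xs) (take r xs) m)
                 (trans (at-take xs r m m<r) (cong (at xs) (sym emod))))
  where
  m = i ∸ (suc K ∸ r)
  ei' : (suc K ∸ r) + m ≡ i
  ei' = m+[n∸m]≡n (≮⇒≥ ge)
  ei : length (drop r xs) + m ≡ i
  ei = trans (cong (_+ m) (trans (length-drop r xs) (cong (_∸ r) hl))) ei'
  m<r : m < r
  m<r = +-cancelˡ-< (suc K ∸ r) m r (subst₂ _<_ (sym ei') (sym (m∸n+n≡m hr)) hi)
  r+i≡m+K : r + i ≡ m + 1 * suc K
  r+i≡m+K = begin
    r + i                 ≡⟨ cong (r +_) (sym ei') ⟩
    r + ((suc K ∸ r) + m) ≡⟨ sym (+-assoc r _ m) ⟩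
    (r + (suc K ∸ r)) + m ≡⟨ cong (_+ m) (m+[n∸m]≡n hr) ⟩
    suc K + m             ≡⟨ solve 2 (λ k m → k :+ m := m :+ con 1 :* k) refl (suc K) m ⟩
    m + 1 * suc K         ∎
  emod : (r + i) % suc K ≡ m
  emod = trans (cong (_% suc K) r+i≡m+K) (trans ([m+kn]%n≡m%n m 1 (suc K)) (m<n⇒m%n≡m (<-≤-trans m<r hr)))

snoc-at : ∀ (xs : List ℕ) k → length xs ≡ suc k → xs ≡ take k xs ++ [ at xs k ]
snoc-at (x ∷ []) zero _ = refl
snoc-at (x ∷ y ∷ xs) zero ()
snoc-at (x ∷ xs) (suc k) e = cong (x ∷_) (snoc-at xs k (suc-injective e))

lastOr-at : ∀ x xs → lastOr x xs ≡ at (x ∷ xs) (length xs)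
lastOr-at x [] = refl
lastOr-at x (y ∷ xs) = lastOr-at y xs

lastOr-snoc : ∀ d (ws : List ℕ) y → lastOr d (ws ++ [ y ]) ≡ y
lastOr-snoc d [] y = refl
lastOr-snoc d (w ∷ ws) y = lastOr-snoc w ws y

lastOr-rev : ∀ d (zs : List ℕ) y ys → lastOr d (zs ++ reverse (y ∷ ys)) ≡ y
lastOr-rev d zs y ys = trans (cong (lastOr d) (trans (cong (zs ++_) (unfold-reverse y ys)) (sym (++-assoc zs (reverse ys) [ y ])))) (lastOr-snoc d (zs ++ reverse ys) y)

rev-cons-snoc : ∀ x (xs : List ℕ) y → reverse (x ∷ xs ++ [ y ]) ≡ y ∷ reverse xs ++ [ x ]
rev-cons-snoc x xs y = trans (unfold-reverse x (xs ++ [ y ])) (cong (_++ [ x ]) (reverse-++ xs [ y ]))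

rev-snoc : ∀ (xs : List ℕ) y → reverse (xs ++ [ y ]) ≡ y ∷ reverse xs
rev-snoc xs y = reverse-++ xs [ y ]

foldl-take-suc : ∀ (f : List ℕ → ℕ → List ℕ) z ws t → t < length ws →
  foldl f z (take (suc t) ws) ≡ f (foldl f z (take t ws)) (at ws t)
foldl-take-suc f z (x ∷ ws) zero _ = refl
foldl-take-suc f z (x ∷ ws) (suc t) (s≤s h) = foldl-take-suc f (f z x) ws t h

range : ℕ → ℕ → List ℕ
range m zero = []
range m (suc N) = m ∷ range (suc m) N

applyUpTo-range : ∀ (f : ℕ → ℕ) m N → (∀ i → f i ≡ m + i) → applyUpTo f N ≡ range m N
applyUpTo-range f m zero h = refl
applyUpTo-range f m (suc N) h = cong₂ _∷_ (trans (h 0) (+-identityʳ m)) (applyUpTo-range (λ i → f (suc i)) (suc m) N (λ i → trans (h (suc i)) (+-suc m i)))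

upTo-range : ∀ N → upTo N ≡ range 0 N
upTo-range N = applyUpTo-range (λ i → i) 0 N (λ i → refl)

between-range : ∀ t1 t2 → between t1 t2 ≡ range (suc t1) (t2 ∸ suc t1)
between-range t1 t2 = trans (map-applyUpTo (λ i → i) (λ i → suc t1 + i) (t2 ∸ suc t1))
  (applyUpTo-range _ (suc t1) (t2 ∸ suc t1) (λ i → refl))

range-split : ∀ m A B → range m (A + suc B) ≡ range m A ++ (m + A) ∷ range (suc (m + A)) B
range-split m zero B rewrite +-identityʳ m = refl
range-split m (suc A) B rewrite +-suc m A = cong (m ∷_) (range-split (suc m) A B)

length-range : ∀ m N → length (range m N) ≡ N
length-range m zero = refl
length-range m (suc N) = cong suc (length-range (suc m) N)

at-range : ∀ m N i → i < N → at (range m N) i ≡ m + i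
at-range m (suc N) zero _ = sym (+-identityʳ m)
at-range m (suc N) (suc i) (s≤s h) = trans (at-range (suc m) N i h) (sym (+-suc m i))

map-range-cong : ∀ (h h' : ℕ → ℕ) m N → (∀ i → m ≤ i → i < m + N → h i ≡ h' i) → map h (range m N) ≡ map h' (range m N)
map-range-cong h h' m zero e = refl
map-range-cong h h' m (suc N) e = cong₂ _∷_ (e m ≤-refl (m<m+n m (s≤s z≤n)))
  (map-range-cong h h' (suc m) N (λ i h1 h2 → e i (≤-trans (n≤1+n m) h1) (subst (i <_) (sym (+-suc m N)) h2)))

map-suc-range : ∀ (h : ℕ → ℕ) m N → map (λ j → h (suc j)) (range m N) ≡ map h (range (suc m) N)
map-suc-range h m zero = refl
map-suc-range h m (suc N) = cong (h (suc m) ∷_) (map-suc-range h (suc m) N)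

range-split-at : ∀ m N x → m ≤ x → x < m + N → range m N ≡ range m (x ∸ m) ++ x ∷ range (suc x) (m + N ∸ suc x)
range-split-at m N x h1 h2 = begin
    range m N ≡⟨ cong (range m) (sym eN) ⟩
    range m ((x ∸ m) + suc (m + N ∸ suc x)) ≡⟨ range-split m (x ∸ m) (m + N ∸ suc x) ⟩
    range m (x ∸ m) ++ (m + (x ∸ m)) ∷ range (suc (m + (x ∸ m))) (m + N ∸ suc x) ≡⟨ cong (λ z → range m (x ∸ m) ++ z ∷ range (suc z) (m + N ∸ suc x)) ex ⟩
    range m (x ∸ m) ++ x ∷ range (suc x) (m + N ∸ suc x) ∎
  where
  ex : m + (x ∸ m) ≡ x
  ex = m+[n∸m]≡n h1
  e2 : suc x + (m + N ∸ suc x) ≡ m + N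
  e2 = m+[n∸m]≡n h2
  eN : (x ∸ m) + suc (m + N ∸ suc x) ≡ N
  eN = +-cancelˡ-≡ m _ _ (begin
       m + ((x ∸ m) + suc (m + N ∸ suc x)) ≡⟨ sym (+-assoc m (x ∸ m) _) ⟩
       (m + (x ∸ m)) + suc (m + N ∸ suc x) ≡⟨ cong (_+ suc (m + N ∸ suc x)) ex ⟩
       x + suc (m + N ∸ suc x) ≡⟨ +-suc x _ ⟩
       suc x + (m + N ∸ suc x) ≡⟨ e2 ⟩
       m + N ∎)

module _ {A : Set} (b : A → Bool) where
  filter-accept-true : ∀ x xs → b x ≡ true → filter (λ c → T? (b c)) (x ∷ xs) ≡ x ∷ filter (λ c → T? (b c)) xs
  filter-accept-true x xs e rewrite e = refl

  filter-reject-false : ∀ x xs → b x ≡ false → filter (λ c → T? (b c)) (x ∷ xs) ≡ filter (λ c → T? (b c)) xs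
  filter-reject-false x xs e rewrite e = refl

filter-map-T : ∀ {A B : Set} (b : B → Bool) (g : A → B) xs →
  filter (λ c → T? (b c)) (map g xs) ≡ map g (filter (λ c → T? (b (g c))) xs)
filter-map-T b g [] = refl
filter-map-T b g (x ∷ xs) = helper (b (g x)) refl
  where
  helper : ∀ v → b (g x) ≡ v → filter (λ c → T? (b c)) (map g (x ∷ xs)) ≡ map g (filter (λ c → T? (b (g c))) (x ∷ xs))
  helper true e = trans (filter-accept-true b (g x) (map g xs) e) (trans (cong (g x ∷_) (filter-map-T b g xs)) (cong (map g) (sym (filter-accept-true (λ c → b (g c)) x xs e))))
  helper false e = trans (filter-reject-false b (g x) (map g xs) e) (trans (filter-map-T b g xs) (cong (map g) (sym (filter-reject-false (λ c → b (g c)) x xs e))))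

module _ (f : ℕ × ℕ → Bool) (g : ℕ → ℕ × ℕ) where
  count≡0⇒none : ∀ m N → count f (map g (range m N)) ≡ 0 → ∀ x → m ≤ x → x < m + N → f (g x) ≡ true → ⊥
  count≡0⇒none m zero c x h1 h2 fx = <-irrefl refl (<-≤-trans (subst (x <_) (+-identityʳ m) h2) h1)
  count≡0⇒none m (suc N) c x h1 h2 fx with f (g m) in e
  count≡0⇒none m (suc N) () x h1 h2 fx | true
  ... | false with m ≟ x
  ... | yes refl = false≢true (trans (sym e) fx)
  ... | no ne = count≡0⇒none (suc m) N c x (≤∧≢⇒< h1 ne) (subst (x <_) (+-suc m N) h2) fx

  count≡1⇒unique : ∀ m N → count f (map g (range m N)) ≡ 1 → ∀ x y → m ≤ x → x < m + N → m ≤ y → y < m + N →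
    f (g x) ≡ true → f (g y) ≡ true → x ≡ y
  count≡1⇒unique m zero c x y hx1 hx2 hy1 hy2 fx fy = ⊥-elim (<-irrefl refl (<-≤-trans (subst (x <_) (+-identityʳ m) hx2) hx1))
  count≡1⇒unique m (suc N) c x y hx1 hx2 hy1 hy2 fx fy with f (g m) in e
  ... | true with m ≟ x | m ≟ y
  ... | yes refl | yes refl = refl
  ... | yes refl | no ne = ⊥-elim (count≡0⇒none (suc m) N (suc-injective c) y (≤∧≢⇒< hy1 ne) (subst (y <_) (+-suc m N) hy2) fy)
  ... | no ne | _ = ⊥-elim (count≡0⇒none (suc m) N (suc-injective c) x (≤∧≢⇒< hx1 ne) (subst (x <_) (+-suc m N) hx2) fx)
  count≡1⇒unique m (suc N) c x y hx1 hx2 hy1 hy2 fx fy | false with m ≟ x | m ≟ y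
  ... | yes refl | _ = ⊥-elim (false≢true (trans (sym e) fx))
  ... | no _ | yes refl = ⊥-elim (false≢true (trans (sym e) fy))
  ... | no n1 | no n2 = count≡1⇒unique (suc m) N c x y (≤∧≢⇒< hx1 n1) (subst (x <_) (+-suc m N) hx2) (≤∧≢⇒< hy1 n2) (subst (y <_) (+-suc m N) hy2) fx fy

  count≥1⇒some : ∀ m N → 1 ≤ count f (map g (range m N)) → Σ ℕ λ x → m ≤ x × x < m + N × f (g x) ≡ true
  count≥1⇒some m zero ()
  count≥1⇒some m (suc N) c with f (g m) in e
  ... | true = m , ≤-refl , m<m+n m (s≤s z≤n) , e
  ... | false with count≥1⇒some (suc m) N c
  ... | x , h1 , h2 , h3 = x , ≤-trans (n≤1+n m) h1 , subst (x <_) (sym (+-suc m N)) h2 , h3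

module Enumeration (b : ℕ → Bool) where
  Enumerates : ℕ → ℕ → List ℕ → Set
  Enumerates m M [] = m ≤ M × (∀ t → m ≤ t → t < M → b t ≡ true → ⊥)
  Enumerates m M (x ∷ l) = m ≤ x × x < M × b x ≡ true × (∀ t → m ≤ t → t < x → b t ≡ true → ⊥) × Enumerates (suc x) M l

  enumerates-≤ : ∀ m M l → Enumerates m M l → m ≤ M
  enumerates-≤ m M [] (h , _) = h
  enumerates-≤ m M (x ∷ l) (h1 , h2 , _) = ≤-trans h1 (<⇒≤ h2)

  private
    none-weaken : ∀ m u → b m ≡ false → (∀ t → suc m ≤ t → t < u → b t ≡ true → ⊥) → ∀ t → m ≤ t → t < u → b t ≡ true → ⊥
    none-weaken m u e h t h1 h2 bt with m ≟ t
    ... | yes refl = false≢true (trans (sym e) bt)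
    ... | no ne = h t (≤∧≢⇒< h1 ne) h2 bt

  enumerates-weaken : ∀ m M l → b m ≡ false → Enumerates (suc m) M l → Enumerates m M l
  enumerates-weaken m M [] e (h1 , h2) = ≤-trans (n≤1+n m) h1 , none-weaken m M e h2
  enumerates-weaken m M (x ∷ l) e (h1 , h2 , h3 , h4 , h5) = ≤-trans (n≤1+n m) h1 , h2 , h3 , none-weaken m x e h4 , h5

  filter-enumerates : ∀ m N → Enumerates m (m + N) (filter (λ c → T? (b c)) (range m N))
  filter-enumerates m zero = m≤m+n m 0 , λ t h1 h2 _ → <-irrefl refl (<-≤-trans (subst (t <_) (+-identityʳ m) h2) h1)
  filter-enumerates m (suc N) = helper (b m) refl
    where
    ih : Enumerates (suc m) (m + suc N) (filter (λ c → T? (b c)) (range (suc m) N))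
    ih = subst (λ z → Enumerates (suc m) z (filter (λ c → T? (b c)) (range (suc m) N))) (sym (+-suc m N)) (filter-enumerates (suc m) N)
    helper : ∀ v → b m ≡ v → Enumerates m (m + suc N) (filter (λ c → T? (b c)) (range m (suc N)))
    helper true e rewrite filter-accept-true b m (range (suc m) N) e =
      ≤-refl , m<m+n m (s≤s z≤n) , e , (λ t h1 h2 _ → <-irrefl refl (<-≤-trans h2 h1)) , ih
    helper false e rewrite filter-reject-false b m (range (suc m) N) e = enumerates-weaken m (m + suc N) _ e ih

  enumerates-unique : ∀ m M l1 l2 → Enumerates m M l1 → Enumerates m M l2 → l1 ≡ l2
  enumerates-unique m M [] [] _ _ = refl
  enumerates-unique m M [] (y ∷ l2) (_ , h) (y1 , y2 , y3 , _) = ⊥-elim (h y y1 y2 y3)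
  enumerates-unique m M (x ∷ l1) [] (x1 , x2 , x3 , _) (_ , h) = ⊥-elim (h x x1 x2 x3)
  enumerates-unique m M (x ∷ l1) (y ∷ l2) (x1 , x2 , x3 , x4 , x5) (y1 , y2 , y3 , y4 , y5) with <-cmp x y
  ... | tri< lt _ _ = ⊥-elim (y4 x x1 lt x3)
  ... | tri> _ _ gt = ⊥-elim (x4 y y1 gt y3)
  ... | tri≈ _ refl _ = cong (x ∷_) (enumerates-unique (suc x) M l1 l2 x5 y5)

  enumerates-true : ∀ m M Λ → Enumerates m M Λ → ∀ i → i < length Λ → b (at Λ i) ≡ true
  enumerates-true m M (x ∷ Λ) (_ , _ , h , _) zero _ = h
  enumerates-true m M (x ∷ Λ) (_ , _ , _ , _ , g) (suc i) (s≤s hi) = enumerates-true (suc x) M Λ g i hi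

  enumerates-consecutive : ∀ lo hi Λ → Enumerates (suc lo) hi Λ → ∀ i → i ≤ length Λ →
     at (lo ∷ Λ ++ [ hi ]) i < at (lo ∷ Λ ++ [ hi ]) (suc i) ×
     (∀ t → at (lo ∷ Λ ++ [ hi ]) i < t → t < at (lo ∷ Λ ++ [ hi ]) (suc i) → b t ≡ true → ⊥)
  enumerates-consecutive lo hi [] (h1 , h2) zero _ = h1 , h2
  enumerates-consecutive lo hi (x ∷ Λ) (h1 , h2 , h3 , h4 , h5) zero _ = h1 , h4
  enumerates-consecutive lo hi (x ∷ Λ) (h1 , h2 , h3 , h4 , h5) (suc i) (s≤s hi') = enumerates-consecutive x hi Λ h5 i hi'

  map-enumerates : ∀ (g : ℕ → ℕ) N j →
    (∀ i → j ≤ i → i ≤ j + N → g i < g (suc i)) →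
    (∀ i → j ≤ i → i ≤ j + N → ∀ t → g i < t → t < g (suc i) → b t ≡ true → ⊥) →
    (∀ i → j < i → i ≤ j + N → b (g i) ≡ true) →
    Enumerates (suc (g j)) (g (suc (j + N))) (map g (range (suc j) N))
  map-enumerates g zero j inc gp pb =
    subst (λ z → suc (g j) ≤ g (suc z)) (sym (+-identityʳ j)) (inc j ≤-refl (≤-reflexive (sym (+-identityʳ j)))) ,
    subst (λ z → ∀ t → suc (g j) ≤ t → t < g (suc z) → b t ≡ true → ⊥) (sym (+-identityʳ j)) (gp j ≤-refl (≤-reflexive (sym (+-identityʳ j))))
  map-enumerates g (suc N) j inc gp pb =
    inc j ≤-refl (m≤m+n j _) ,
    subst (λ z → g (suc j) < g (suc z)) (sym (+-suc j N)) (enumerates-≤ _ _ _ ih) ,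
    pb (suc j) ≤-refl (subst (suc j ≤_) (sym (+-suc j N)) (s≤s (m≤m+n j N))) ,
    gp j ≤-refl (m≤m+n j _) ,
    subst (λ z → Enumerates (suc (g (suc j))) (g (suc z)) (map g (range (suc (suc j)) N))) (sym (+-suc j N)) ih
    where
    e : suc j + N ≡ j + suc N
    e = sym (+-suc j N)
    ih : Enumerates (suc (g (suc j))) (g (suc (suc j + N))) (map g (range (suc (suc j)) N))
    ih = map-enumerates g N (suc j)
      (λ i h1 h2 → inc i (≤-trans (n≤1+n j) h1) (subst (i ≤_) e h2))
      (λ i h1 h2 → gp i (≤-trans (n≤1+n j) h1) (subst (i ≤_) e h2))
      (λ i h1 h2 → pb i (≤-trans (n≤1+n (suc j)) h1) (subst (i ≤_) e h2))

module AdjacentInFilter (b : ℕ → Bool) (F : ℕ → ℕ) where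
  open Enumeration b

  filter-range-empty : ∀ m D → (∀ t → m ≤ t → t < m + D → b t ≡ true → ⊥) → filter (λ c → T? (b c)) (range m D) ≡ []
  filter-range-empty m D h = enumerates-unique m (m + D) _ [] (filter-enumerates m D) (m≤m+n m D , h)

  adjacentIn-intro : ∀ N θ1 θ2 → θ1 < θ2 → θ2 < N → b θ1 ≡ true → b θ2 ≡ true →
    (∀ t → θ1 < t → t < θ2 → b t ≡ true → ⊥) →
    ∃ λ xs → ∃ λ ys → map F (filter (λ c → T? (b c)) (range 0 N)) ≡ xs ++ F θ1 ∷ F θ2 ∷ ys
  adjacentIn-intro N θ1 θ2 lt hN b1 b2 gp =
    map F (fl (range 0 θ1)) , map F (fl R2) , (begin
      map F (fl (range 0 N)) ≡⟨ cong (λ z → map F (fl z)) e1 ⟩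
      map F (fl (range 0 θ1 ++ θ1 ∷ R1)) ≡⟨ cong (map F) (filter-++ (λ c → T? (b c)) (range 0 θ1) (θ1 ∷ R1)) ⟩
      map F (fl (range 0 θ1) ++ fl (θ1 ∷ R1)) ≡⟨ cong (λ z → map F (fl (range 0 θ1) ++ z)) (filter-accept-true b θ1 R1 b1) ⟩
      map F (fl (range 0 θ1) ++ θ1 ∷ fl R1) ≡⟨ cong (λ z → map F (fl (range 0 θ1) ++ θ1 ∷ fl z)) e2 ⟩
      map F (fl (range 0 θ1) ++ θ1 ∷ fl (range (suc θ1) (θ2 ∸ suc θ1) ++ θ2 ∷ R2)) ≡⟨ cong (λ z → map F (fl (range 0 θ1) ++ θ1 ∷ z)) (filter-++ (λ c → T? (b c)) (range (suc θ1) (θ2 ∸ suc θ1)) (θ2 ∷ R2)) ⟩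
      map F (fl (range 0 θ1) ++ θ1 ∷ (fl (range (suc θ1) (θ2 ∸ suc θ1)) ++ fl (θ2 ∷ R2))) ≡⟨ cong₂ (λ z1 z2 → map F (fl (range 0 θ1) ++ θ1 ∷ (z1 ++ z2))) emid (filter-accept-true b θ2 R2 b2) ⟩
      map F (fl (range 0 θ1) ++ θ1 ∷ θ2 ∷ fl R2) ≡⟨ map-++ F (fl (range 0 θ1)) (θ1 ∷ θ2 ∷ fl R2) ⟩
      map F (fl (range 0 θ1)) ++ F θ1 ∷ F θ2 ∷ map F (fl R2) ∎)
    where
    fl : List ℕ → List ℕ
    fl = filter (λ c → T? (b c))
    R1 = range (suc θ1) (0 + N ∸ suc θ1)
    R2 = range (suc θ2) (suc θ1 + (0 + N ∸ suc θ1) ∸ suc θ2)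
    hN' : θ2 < suc θ1 + (0 + N ∸ suc θ1)
    hN' = subst (θ2 <_) (sym (m+[n∸m]≡n (<-trans lt hN))) hN
    e1 : range 0 N ≡ range 0 θ1 ++ θ1 ∷ R1
    e1 = range-split-at 0 N θ1 z≤n (<-trans lt hN)
    e2 : R1 ≡ range (suc θ1) (θ2 ∸ suc θ1) ++ θ2 ∷ R2
    e2 = range-split-at (suc θ1) (0 + N ∸ suc θ1) θ2 lt hN'
    emid : fl (range (suc θ1) (θ2 ∸ suc θ1)) ≡ []
    emid = filter-range-empty (suc θ1) (θ2 ∸ suc θ1) (λ t h1 h2 → gp t h1 (subst (t <_) (m+[n∸m]≡n lt) h2))

  map-split-adjacent : ∀ L xs a c ys → map F L ≡ xs ++ a ∷ c ∷ ys →
    ∃ λ L1 → ∃ λ θ1 → ∃ λ θ2 → ∃ λ L2 → L ≡ L1 ++ θ1 ∷ θ2 ∷ L2 × F θ1 ≡ a × F θ2 ≡ c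
  map-split-adjacent (θ1 ∷ θ2 ∷ L2) [] a c ys e with ∷-injective e
  ... | e1 , e2 with ∷-injective e2
  ... | e3 , _ = [] , θ1 , θ2 , L2 , refl , e1 , e3
  map-split-adjacent [] [] a c ys ()
  map-split-adjacent (θ ∷ []) [] a c ys ()
  map-split-adjacent [] (x ∷ xs) a c ys ()
  map-split-adjacent (θ ∷ L) (x ∷ xs) a c ys e with map-split-adjacent L xs a c ys (proj₂ (∷-injective e))
  ... | L1 , θ1 , θ2 , L2 , e1 , e2 , e3 = θ ∷ L1 , θ1 , θ2 , L2 , cong (θ ∷_) e1 , e2 , e3

  enumerates-suffix : ∀ m M L1 L → Enumerates m M (L1 ++ L) → Σ ℕ λ m' → Enumerates m' M L
  enumerates-suffix m M [] L g = m , g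
  enumerates-suffix m M (x ∷ L1) L (_ , _ , _ , _ , g) = enumerates-suffix (suc x) M L1 L g

  adjacentIn-elim : ∀ N xs a c ys → map F (filter (λ c → T? (b c)) (range 0 N)) ≡ xs ++ a ∷ c ∷ ys →
    ∃ λ θ1 → ∃ λ θ2 → θ1 < θ2 × θ2 < N × b θ1 ≡ true × b θ2 ≡ true ×
      (∀ t → θ1 < t → t < θ2 → b t ≡ true → ⊥) × F θ1 ≡ a × F θ2 ≡ c
  adjacentIn-elim N xs a c ys e with map-split-adjacent _ xs a c ys e
  ... | L1 , θ1 , θ2 , L2 , eL , ea , ec with enumerates-suffix 0 N L1 (θ1 ∷ θ2 ∷ L2) (subst (Enumerates 0 N) eL (filter-enumerates 0 N))
  ... | m' , (_ , x2 , x3 , _ , (y1 , y2 , y3 , y4 , _)) = θ1 , θ2 , y1 , y2 , x3 , y3 , (λ t h1 h2 → y4 t h1 h2) , ea , ec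

first-hit-unique : ∀ (W : ℕ → ℕ) p t1 tL tU → t1 < tL → t1 < tU → W tL ≡ p → W tU ≡ p →
  (∀ t → t1 < t → t < tL → W t ≢ p) → (∀ t → t1 < t → t < tU → W t ≢ p) → tU ≡ tL
first-hit-unique W p t1 tL tU h1 h2 eL eU nL nU with <-cmp tU tL
... | tri≈ _ e _ = e
... | tri< lt _ _ = ⊥-elim (nL tU h2 lt eU)
... | tri> _ _ gt = ⊥-elim (nU tL h1 gt eL)

-- Arithmetic

quotients-differ-by : ∀ c e K .{{_ : NonZero K}} → (c + e) % K ≡ c % K → c / K * K + e ≡ (c + e) / K * K
quotients-differ-by c e K h = +-cancelˡ-≡ (c % K) _ _ (begin
  c % K + (c / K * K + e)       ≡⟨ sym (+-assoc (c % K) _ e) ⟩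
  (c % K + c / K * K) + e       ≡⟨ cong (_+ e) (sym (m≡m%n+[m/n]*n c K)) ⟩
  c + e                         ≡⟨ m≡m%n+[m/n]*n (c + e) K ⟩
  (c + e) % K + (c + e) / K * K ≡⟨ cong (_+ (c + e) / K * K) h ⟩
  c % K + (c + e) / K * K       ∎)

[m+e]%n≡m%n⇒e≡0 : ∀ c e K .{{_ : NonZero K}} → (c + e) % K ≡ c % K → e < K → e ≡ 0
[m+e]%n≡m%n⇒e≡0 c e K h e<K with (c + e) / K ≤? c / K
... | yes le = n≤0⇒n≡0 (+-cancelˡ-≤ (c / K * K) e 0
    (≤-trans (≤-reflexive (quotients-differ-by c e K h)) (≤-trans (*-monoˡ-≤ K le) (≤-reflexive (sym (+-identityʳ _))))))
... | no gt = contradiction e<K (≤⇒≯ (+-cancelˡ-≤ (c / K * K) K e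
    (≤-trans (≤-reflexive (+-comm _ K)) (≤-trans (*-monoˡ-≤ K (≰⇒> gt)) (≤-reflexive (sym (quotients-differ-by c e K h)))))))

[m+e]%n≡m%n⇒e≡n : ∀ c e K .{{_ : NonZero K}} → (c + e) % K ≡ c % K → 0 < e → e < K + K → e ≡ K
[m+e]%n≡m%n⇒e≡n c e K h e0 e2 with e <? K
... | yes lt = ⊥-elim (<-irrefl (sym ([m+e]%n≡m%n⇒e≡0 c e K h lt)) e0)
... | no ge = trans (sym (m+[n∸m]≡n K≤e)) (trans (cong (K +_) e'0) (+-identityʳ K))
  where
  K≤e : K ≤ e
  K≤e = ≮⇒≥ ge
  e' = e ∸ K
  eq1 : c + e ≡ (c + e') + 1 * K
  eq1 = begin
    c + e ≡⟨ cong (c +_) (sym (m+[n∸m]≡n K≤e)) ⟩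
    c + (K + e') ≡⟨ cong (c +_) (+-comm K e') ⟩
    c + (e' + K) ≡⟨ sym (+-assoc c e' K) ⟩
    (c + e') + K ≡⟨ cong ((c + e') +_) (sym (+-identityʳ K)) ⟩
    (c + e') + 1 * K ∎
  e'<K : e' < K
  e'<K = +-cancelˡ-< K e' K (subst (_< K + K) (sym (m+[n∸m]≡n K≤e)) e2)
  e'0 : e' ≡ 0
  e'0 = [m+e]%n≡m%n⇒e≡0 c e' K (trans (sym ([m+kn]%n≡m%n (c + e') 1 K)) (trans (cong (_% K) (sym eq1)) h)) e'<K

%-absorbˡ : ∀ a b K .{{_ : NonZero K}} → (a % K + b) % K ≡ (a + b) % K
%-absorbˡ a b K = trans (%-distribˡ-+ (a % K) b K) (trans (cong (λ z → (z + b % K) % K) (m%n%n≡m%n a K)) (sym (%-distribˡ-+ a b K)))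

argmin : (f : ℕ → ℕ) (M : ℕ) → Σ ℕ λ s → s < suc M × (∀ m → m < suc M → f s ≤ f m)
argmin f zero = 0 , s≤s z≤n , λ { zero _ → ≤-refl ; (suc m) (s≤s ()) }
argmin f (suc M) with argmin f M
... | s , hs , hmin with f s ≤? f (suc M)
... | yes le = s , ≤-trans hs (n≤1+n _) , λ m hm → case1 m hm
  where case1 : ∀ m → m < suc (suc M) → f s ≤ f m
        case1 m hm with m<1+n⇒m<n∨m≡n hm
        ... | inj₁ lt = hmin m lt
        ... | inj₂ refl = le
... | no gt = suc M , ≤-refl , λ m hm → case2 m hm
  where case2 : ∀ m → m < suc (suc M) → f (suc M) ≤ f m
        case2 m hm with m<1+n⇒m<n∨m≡n hm
        ... | inj₁ lt = ≤-trans (<⇒≤ (≰⇒> gt)) (hmin m lt)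
        ... | inj₂ refl = ≤-refl

≤-suc-cases : ∀ {m i} → m ≤ suc i → m ≤ i ⊎ m ≡ suc i
≤-suc-cases h with m≤n⇒m<n∨m≡n h
... | inj₁ lt = inj₁ (≤-pred lt)
... | inj₂ e = inj₂ e

Between : ℕ → ℕ → ℕ → Set
Between a b t = (a < t × t < b) ⊎ (b < t × t < a)

Between-sym : ∀ {a b t} → Between a b t → Between b a t
Between-sym (inj₁ x) = inj₂ x
Between-sym (inj₂ x) = inj₁ x

-- Cyclic triples

module CyclicTriples (P : ℕ × ℕ × ℕ → Set) where
  private
    subst-triple : ∀ {a a′ b b′ c c′} → a ≡ a′ → b ≡ b′ → c ≡ c′ → P (a , b , c) → P (a′ , b′ , c′)
    subst-triple refl refl refl p = p

  windows3-at : ∀ l → All P (windows3 l) → ∀ j → 2 + j < length l → P (at l j , at l (1 + j) , at l (2 + j))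
  windows3-at (a ∷ b ∷ c ∷ xs) (h ∷ _) zero _ = h
  windows3-at (a ∷ b ∷ c ∷ xs) (_ ∷ hs) (suc j) (s≤s lt) = windows3-at (b ∷ c ∷ xs) hs j lt
  windows3-at (a ∷ []) _ j (s≤s ())
  windows3-at (a ∷ b ∷ []) _ j (s≤s (s≤s ()))

  windows3-from-at : ∀ l → (∀ j → 2 + j < length l → P (at l j , at l (1 + j) , at l (2 + j))) → All P (windows3 l)
  windows3-from-at [] h = []
  windows3-from-at (a ∷ []) h = []
  windows3-from-at (a ∷ b ∷ []) h = []
  windows3-from-at (a ∷ b ∷ c ∷ xs) h = h 0 (s≤s (s≤s (s≤s z≤n))) ∷ windows3-from-at (b ∷ c ∷ xs) (λ j lt → h (suc j) (s≤s lt))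

  windows3-++ : ∀ xs y z ys → All P (windows3 (xs ++ y ∷ z ∷ [])) → All P (windows3 (y ∷ z ∷ ys)) →
    All P (windows3 (xs ++ y ∷ z ∷ ys))
  windows3-++ [] y z ys h1 h2 = h2
  windows3-++ (x ∷ []) y z ys (h ∷ _) h2 = h ∷ h2
  windows3-++ (x ∷ x' ∷ []) y z ys (h ∷ h1) h2 = h ∷ windows3-++ (x' ∷ []) y z ys h1 h2
  windows3-++ (x ∷ x' ∷ x'' ∷ xs) y z ys (h ∷ h1) h2 = h ∷ windows3-++ (x' ∷ x'' ∷ xs) y z ys h1 h2

  windows3-reverse : (∀ {a b c} → P (a , b , c) → P (c , b , a)) →
    ∀ xs → All P (windows3 xs) → All P (windows3 (reverse xs))
  windows3-reverse flip xs h = windows3-from-at (reverse xs) triple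
    where
    triple : ∀ j → 2 + j < length (reverse xs) → P (at (reverse xs) j , at (reverse xs) (1 + j) , at (reverse xs) (2 + j))
    triple j lt = subst-triple (trans (cong (at xs) (+-comm 2 k)) (sym (at-reverse-≡ xs k 2 j eL)))
                               (trans (cong (at xs) (+-comm 1 k)) (sym (at-reverse-≡ xs k 1 (1 + j) eL)))
                               (sym (trans (at-reverse-≡ xs k 0 (2 + j) eL) (cong (at xs) (+-identityʳ k))))
                               (flip (windows3-at xs h k k+2<))
      where
      3+j≤ : 3 + j ≤ length xs
      3+j≤ = subst (2 + j <_) (length-reverse xs) lt
      k = length xs ∸ (3 + j)
      eL : length xs ≡ k + (3 + j)
      eL = sym (m∸n+n≡m 3+j≤)
      k+2< : 2 + k < length xs
      k+2< = subst (2 + k <_) (sym eL) (≤-trans (m≤m+n (3 + k) j) (≤-reflexive (solve 2 (λ k j → con 3 :+ k :+ j := k :+ (con 3 :+ j)) refl k j)))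

  IsPeriodic : ℕ → List ℕ → Set
  IsPeriodic K ys = ∀ m → P (at ys (m % suc K) , at ys ((1 + m) % suc K) , at ys ((2 + m) % suc K))

  private
    module Unrolled (x : ℕ) (xs : List ℕ) where
      K = suc (length xs)

      l : List ℕ
      l = lastOr x xs ∷ x ∷ xs ++ [ x ]

      length-l : length l ≡ 2 + K
      length-l = cong (λ z → suc (suc z)) (trans (length-++ xs) (+-comm (length xs) 1))

      at-l : ∀ i → i ≤ suc K → at l i ≡ at (x ∷ xs) ((i + length xs) % K)
      at-l zero _ = trans (lastOr-at x xs) (cong (at (x ∷ xs)) (sym (m<n⇒m%n≡m (n<1+n (length xs)))))
      at-l (suc i) h with m≤n⇒m<n∨m≡n (≤-pred h)
      ... | inj₁ lt = trans (at-++ˡ (x ∷ xs) [ x ] i lt)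
                        (cong (at (x ∷ xs)) (trans (sym (m<n⇒m%n≡m lt)) (trans (sym ([m+n]%n≡m%n i K)) (cong (_% K) (+-suc i (length xs))))))
      ... | inj₂ refl = trans (subst (λ z → at ((x ∷ xs) ++ [ x ]) z ≡ x) (+-identityʳ K) (at-++ʳ (x ∷ xs) [ x ] 0))
                          (cong (at (x ∷ xs)) (sym (trans (cong (_% K) (sym (+-suc K (length xs)))) (trans ([m+n]%n≡m%n K K) (n%n≡0 K)))))

      shift-window : ∀ m d → (d + ((1 + m) % K + length xs)) % K ≡ (d + m) % K
      shift-window m d = begin
        (d + ((1 + m) % K + length xs)) % K ≡⟨ cong (_% K) (solve 3 (λ a b c → a :+ (b :+ c) := b :+ (a :+ c)) refl d ((1 + m) % K) (length xs)) ⟩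
        ((1 + m) % K + (d + length xs)) % K ≡⟨ %-absorbˡ (1 + m) (d + length xs) K ⟩
        ((1 + m) + (d + length xs)) % K     ≡⟨ cong (_% K) (solve 3 (λ m d k → (con 1 :+ m) :+ (d :+ k) := (d :+ m) :+ (con 1 :+ k)) refl m d (length xs)) ⟩
        ((d + m) + K) % K                   ≡⟨ [m+n]%n≡m%n (d + m) K ⟩
        (d + m) % K                         ∎

  cyclicTriples⇒periodic : ∀ x xs → All P (cyclicTriples (x ∷ xs)) → IsPeriodic (length xs) (x ∷ xs)
  cyclicTriples⇒periodic x xs h m =
    subst-triple (trans (at-l j (≤-trans (<⇒≤ j<K) (n≤1+n K))) (cong (at (x ∷ xs)) (shift-window m 0)))
                 (trans (at-l (1 + j) (≤-trans j<K (n≤1+n K))) (cong (at (x ∷ xs)) (shift-window m 1)))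
                 (trans (at-l (2 + j) (s≤s j<K)) (cong (at (x ∷ xs)) (shift-window m 2)))
                 (windows3-at l h j (subst (2 + j <_) (sym length-l) (s≤s (s≤s j<K))))
    where
    open Unrolled x xs
    j = (1 + m) % K
    j<K : j < K
    j<K = m%n<n (1 + m) K

  periodic⇒cyclicTriples : ∀ ys K → length ys ≡ suc K → IsPeriodic K ys → All P (cyclicTriples ys)
  periodic⇒cyclicTriples (x ∷ xs) _ refl h = windows3-from-at l λ j lt →
    let j<K = ≤-pred (≤-pred (subst (2 + j <_) length-l lt)) in
    subst-triple (sym (at-l j (≤-trans (<⇒≤ j<K) (n≤1+n K)))) (sym (at-l (1 + j) (≤-trans j<K (n≤1+n K))))
                 (sym (at-l (2 + j) (s≤s j<K))) (h (j + length xs))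
    where open Unrolled x xs

  private
    periodic-rotate : ∀ xs K r → length xs ≡ suc K → IsPeriodic K xs → IsPeriodic K (rotate r xs)
    periodic-rotate xs K r hl h m with r ≤? suc K
    ... | yes hr = subst-triple (shifted 0) (shifted 1) (shifted 2) (h (r + m))
      where
      shifted : ∀ d → at xs ((d + (r + m)) % suc K) ≡ at (rotate r xs) ((d + m) % suc K)
      shifted d = sym (begin
        at (rotate r xs) ((d + m) % suc K)   ≡⟨ at-rotate xs K r hl hr ((d + m) % suc K) (m%n<n (d + m) (suc K)) ⟩
        at xs ((r + (d + m) % suc K) % suc K) ≡⟨ cong (λ z → at xs (z % suc K)) (+-comm r ((d + m) % suc K)) ⟩
        at xs (((d + m) % suc K + r) % suc K) ≡⟨ cong (at xs) (%-absorbˡ (d + m) r (suc K)) ⟩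
        at xs ((d + m + r) % suc K)           ≡⟨ cong (λ z → at xs (z % suc K)) (solve 3 (λ d m r → d :+ m :+ r := d :+ (r :+ m)) refl d m r) ⟩
        at xs ((d + (r + m)) % suc K)         ∎)
    ... | no hr = subst (λ z → P (at z (m % suc K) , at z ((1 + m) % suc K) , at z ((2 + m) % suc K))) (sym rotate-id) (h m)
      where
      le : length xs ≤ r
      le = subst (_≤ r) (sym hl) (<⇒≤ (≰⇒> hr))
      rotate-id : rotate r xs ≡ xs
      rotate-id = cong₂ _++_ (drop-all r xs le) (take-all r xs le)

    reverse-index-mod : ∀ K j → (K * (1 + j)) % suc K ≡ K ∸ (j % suc K)
    reverse-index-mod K j = begin
        (K * (1 + j)) % suc K                  ≡⟨ cong (_% suc K) unfold ⟩
        ((K ∸ r) + (r + K * q) * suc K) % suc K ≡⟨ [m+kn]%n≡m%n (K ∸ r) (r + K * q) (suc K) ⟩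
        (K ∸ r) % suc K                        ≡⟨ m<n⇒m%n≡m (s≤s (m∸n≤m K r)) ⟩
        K ∸ r                                  ∎
      where
      r = j % suc K
      q = j / suc K
      d = K ∸ r
      r+d≡K : r + d ≡ K
      r+d≡K = m+[n∸m]≡n (≤-pred (m%n<n j (suc K)))
      unfold : K * (1 + j) ≡ (K ∸ r) + (r + K * q) * suc K
      unfold = begin
        K * (1 + j)                           ≡⟨ cong (λ z → K * (1 + z)) (m≡m%n+[m/n]*n j (suc K)) ⟩
        K * (1 + (r + q * suc K))             ≡⟨ cong (λ z → z * (1 + (r + q * suc z))) (sym r+d≡K) ⟩
        (r + d) * (1 + (r + q * suc (r + d))) ≡⟨ solve 3 (λ r d q → (r :+ d) :* (con 1 :+ (r :+ q :* (con 1 :+ (r :+ d)))) := d :+ (r :+ (r :+ d) :* q) :* (con 1 :+ (r :+ d))) refl r d q ⟩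
        d + (r + (r + d) * q) * suc (r + d)   ≡⟨ cong (λ z → d + (r + z * q) * suc z) r+d≡K ⟩
        d + (r + K * q) * suc K               ∎

    at-reverse-mod : ∀ xs K → length xs ≡ suc K → ∀ j → at (reverse xs) (j % suc K) ≡ at xs ((K * (1 + j)) % suc K)
    at-reverse-mod xs K hl j = trans (at-reverse xs (j % suc K) (subst (j % suc K <_) (sym hl) (m%n<n j (suc K))))
                                 (cong (at xs) (trans (cong (_∸ suc (j % suc K)) hl) (sym (reverse-index-mod K j))))

    periodic-reverse : (∀ {a b c} → P (a , b , c) → P (c , b , a)) →
      ∀ xs K → length xs ≡ suc K → IsPeriodic K xs → IsPeriodic K (reverse xs)
    periodic-reverse flip xs K hl h m = subst-triple
        (trans (cong (at xs) (trans (cong (_% suc K) e2) ([m+kn]%n≡m%n (K * (1 + m)) 2 (suc K)))) (sym (at-reverse-mod xs K hl m)))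
        (trans (cong (at xs) (trans (cong (_% suc K) e1) ([m+kn]%n≡m%n (K * (2 + m)) 1 (suc K)))) (sym (at-reverse-mod xs K hl (1 + m))))
        (sym (at-reverse-mod xs K hl (2 + m)))
        (flip (h (K * (3 + m))))
      where
      e2 : 2 + K * (3 + m) ≡ K * (1 + m) + 2 * suc K
      e2 = solve 2 (λ k m → con 2 :+ k :* (con 3 :+ m) := k :* (con 1 :+ m) :+ con 2 :* (con 1 :+ k)) refl K m
      e1 : 1 + K * (3 + m) ≡ K * (2 + m) + 1 * suc K
      e1 = solve 2 (λ k m → con 1 :+ k :* (con 3 :+ m) := k :* (con 2 :+ m) :+ con 1 :* (con 1 :+ k)) refl K m

  cyclicTriples-rotate : ∀ xs r → All P (cyclicTriples xs) → All P (cyclicTriples (rotate r xs))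
  cyclicTriples-rotate [] zero h = h
  cyclicTriples-rotate [] (suc r) h = h
  cyclicTriples-rotate (x ∷ xs) r h =
    periodic⇒cyclicTriples (rotate r (x ∷ xs)) (length xs) (length-rotate (x ∷ xs) r)
      (periodic-rotate (x ∷ xs) (length xs) r refl (cyclicTriples⇒periodic x xs h))

  cyclicTriples-reverse : (∀ {a b c} → P (a , b , c) → P (c , b , a)) →
    ∀ xs → All P (cyclicTriples xs) → All P (cyclicTriples (reverse xs))
  cyclicTriples-reverse flip [] h = h
  cyclicTriples-reverse flip (x ∷ xs) h =
    periodic⇒cyclicTriples (reverse (x ∷ xs)) (length xs) (length-reverse (x ∷ xs))
      (periodic-reverse flip (x ∷ xs) (length xs) refl (cyclicTriples⇒periodic x xs h))

-- The sweep

length-swapAt : ∀ p xs → length (swapAt p xs) ≡ length xs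
length-swapAt zero [] = refl
length-swapAt zero (a ∷ []) = refl
length-swapAt zero (a ∷ b ∷ xs) = refl
length-swapAt (suc p) [] = refl
length-swapAt (suc p) (x ∷ xs) = cong suc (length-swapAt p xs)

at-swapAt-left : ∀ p xs → suc p < length xs → at (swapAt p xs) p ≡ at xs (suc p)
at-swapAt-left zero (a ∷ b ∷ xs) _ = refl
at-swapAt-left zero (a ∷ []) (s≤s ())
at-swapAt-left (suc p) (x ∷ xs) (s≤s h) = at-swapAt-left p xs h

at-swapAt-right : ∀ p xs → suc p < length xs → at (swapAt p xs) (suc p) ≡ at xs p
at-swapAt-right zero (a ∷ b ∷ xs) _ = refl
at-swapAt-right zero (a ∷ []) (s≤s ())
at-swapAt-right (suc p) (x ∷ xs) (s≤s h) = at-swapAt-right p xs h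

at-swapAt-other : ∀ p xs q → q ≢ p → q ≢ suc p → at (swapAt p xs) q ≡ at xs q
at-swapAt-other zero [] q _ _ = refl
at-swapAt-other zero (a ∷ []) q _ _ = refl
at-swapAt-other zero (a ∷ b ∷ xs) zero n1 _ = ⊥-elim (n1 refl)
at-swapAt-other zero (a ∷ b ∷ xs) (suc zero) _ n2 = ⊥-elim (n2 refl)
at-swapAt-other zero (a ∷ b ∷ xs) (suc (suc q)) _ _ = refl
at-swapAt-other (suc p) [] q _ _ = refl
at-swapAt-other (suc p) (x ∷ xs) zero _ _ = refl
at-swapAt-other (suc p) (x ∷ xs) (suc q) n1 n2 = at-swapAt-other p xs q (λ e → n1 (cong suc e)) (λ e → n2 (cong suc e))

data SwapCase (p q : ℕ) : Set where
  atLeft : q ≡ p → SwapCase p q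
  atRight : q ≡ suc p → SwapCase p q
  elsewhere : q ≢ p → q ≢ suc p → SwapCase p q

swapCase : ∀ p q → SwapCase p q
swapCase p q with q ≟ p | q ≟ suc p
... | yes e | _ = atLeft e
... | no _ | yes e = atRight e
... | no n1 | no n2 = elsewhere n1 n2

swapIndex : ℕ → ℕ → ℕ
swapIndex p q with swapCase p q
... | atLeft _ = suc p
... | atRight _ = p
... | elsewhere _ _ = q

swapIndex-left : ∀ p → swapIndex p p ≡ suc p
swapIndex-left p with swapCase p p
... | atLeft _ = refl
... | atRight e = ⊥-elim (<-irrefl e (n<1+n p))
... | elsewhere n1 _ = ⊥-elim (n1 refl)

swapIndex-right : ∀ p → swapIndex p (suc p) ≡ p
swapIndex-right p with swapCase p (suc p)
... | atLeft e = ⊥-elim (<-irrefl (sym e) (n<1+n p))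
... | atRight _ = refl
... | elsewhere _ n2 = ⊥-elim (n2 refl)

swapIndex-other : ∀ p q → q ≢ p → q ≢ suc p → swapIndex p q ≡ q
swapIndex-other p q n1 n2 with swapCase p q
... | atLeft e = ⊥-elim (n1 e)
... | atRight e = ⊥-elim (n2 e)
... | elsewhere _ _ = refl

swapIndex-involutive : ∀ p q → swapIndex p (swapIndex p q) ≡ q
swapIndex-involutive p q with swapCase p q
... | atLeft refl = swapIndex-right p
... | atRight refl = swapIndex-left p
... | elsewhere n1 n2 = swapIndex-other p q n1 n2

swapIndex-< : ∀ p q n → suc p < n → q < n → swapIndex p q < n
swapIndex-< p q n hp h with swapCase p q
... | atLeft refl = hp
... | atRight refl = <-trans (n<1+n p) hp
... | elsewhere n1 n2 = h

at-swapAt : ∀ p xs q → suc p < length xs → at (swapAt p xs) q ≡ at xs (swapIndex p q)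
at-swapAt p xs q h with swapCase p q
... | atLeft refl = at-swapAt-left p xs h
... | atRight refl = at-swapAt-right p xs h
... | elsewhere n1 n2 = at-swapAt-other p xs q n1 n2

module Permutation (n : ℕ) where
  IsPermutation : List ℕ → Set
  IsPermutation xs = length xs ≡ n × (∀ q → q < n → at xs q < n) ×
             (∀ q q' → q < n → q' < n → at xs q ≡ at xs q' → q ≡ q') ×
             (∀ x → x < n → ∃ λ q → q < n × at xs q ≡ x)

  upTo-isPermutation : IsPermutation (upTo n)
  upTo-isPermutation = length-applyUpTo (λ i → i) n ,
              (λ q h → subst (_< n) (sym (at-applyUpTo (λ i → i) n q h)) h) ,
              (λ q q' h h' e → trans (sym (at-applyUpTo (λ i → i) n q h)) (trans e (at-applyUpTo (λ i → i) n q' h'))) ,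
              (λ x h → x , h , at-applyUpTo (λ i → i) n x h)

  swapAt-isPermutation : ∀ p xs → suc p < n → IsPermutation xs → IsPermutation (swapAt p xs)
  swapAt-isPermutation p xs hp (hl , hr , hi , hs) = trans (length-swapAt p xs) hl , rg , inj , sur
    where
    hp' : suc p < length xs
    hp' = subst (suc p <_) (sym hl) hp
    rg : ∀ q → q < n → at (swapAt p xs) q < n
    rg q h = subst (_< n) (sym (at-swapAt p xs q hp')) (hr (swapIndex p q) (swapIndex-< p q n hp h))
    inj : ∀ q q' → q < n → q' < n → at (swapAt p xs) q ≡ at (swapAt p xs) q' → q ≡ q'
    inj q q' h h' e = trans (sym (swapIndex-involutive p q)) (trans (cong (swapIndex p) e2) (swapIndex-involutive p q'))
      where e2 : swapIndex p q ≡ swapIndex p q'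
            e2 = hi (swapIndex p q) (swapIndex p q') (swapIndex-< p q n hp h) (swapIndex-< p q' n hp h')
                    (trans (sym (at-swapAt p xs q hp')) (trans e (at-swapAt p xs q' hp')))
    sur : ∀ x → x < n → ∃ λ q → q < n × at (swapAt p xs) q ≡ x
    sur x h with hs x h
    ... | q0 , h0 , e0 = swapIndex p q0 , swapIndex-< p q0 n hp h0 ,
                         trans (at-swapAt p xs (swapIndex p q0) hp') (trans (cong (at xs) (swapIndex-involutive p q0)) e0)

involves-sound : ∀ i a b → involves i (a , b) ≡ true → a ≡ i ⊎ b ≡ i
involves-sound i a b e with a ≡ᵇ i in e1
... | true = inj₁ (≡ᵇ≡true⇒≡ a i e1)
... | false = inj₂ (≡ᵇ≡true⇒≡ b i e)

involves-true : ∀ i a b → a ≡ i ⊎ b ≡ i → involves i (a , b) ≡ true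
involves-true i a b (inj₁ e) rewrite ≡⇒≡ᵇ≡true a i e = refl
involves-true i a b (inj₂ e) with a ≡ᵇ i
... | true = refl
... | false = ≡⇒≡ᵇ≡true b i e

isPair-sound : ∀ i j a b → isPair i j (a , b) ≡ true → (a ≡ i × b ≡ j) ⊎ (a ≡ j × b ≡ i)
isPair-sound i j a b e with a ≡ᵇ i in e1 | b ≡ᵇ j in e2 | a ≡ᵇ j in e3 | b ≡ᵇ i in e4
... | true | true | _ | _ = inj₁ (≡ᵇ≡true⇒≡ a i e1 , ≡ᵇ≡true⇒≡ b j e2)
... | _ | _ | true | true = inj₂ (≡ᵇ≡true⇒≡ a j e3 , ≡ᵇ≡true⇒≡ b i e4)
... | false | _ | false | _ = ⊥-elim (false≢true e)
... | false | _ | true | false = ⊥-elim (false≢true e)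
... | true | false | false | _ = ⊥-elim (false≢true e)
... | true | false | true | false = ⊥-elim (false≢true e)

isPair-true : ∀ i j a b → (a ≡ i × b ≡ j) ⊎ (a ≡ j × b ≡ i) → isPair i j (a , b) ≡ true
isPair-true i j a b (inj₁ (e1 , e2)) rewrite ≡⇒≡ᵇ≡true a i e1 | ≡⇒≡ᵇ≡true b j e2 = refl
isPair-true i j a b (inj₂ (e1 , e2)) rewrite ≡⇒≡ᵇ≡true a j e1 | ≡⇒≡ᵇ≡true b i e2 = ∨-zeroʳ _

other-≡ : ∀ i a b x → a ≢ b → (a ≡ i × b ≡ x) ⊎ (a ≡ x × b ≡ i) → other i (a , b) ≡ x
other-≡ i a b x ne (inj₁ (e1 , e2)) rewrite ≡⇒≡ᵇ≡true a i e1 = e2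
other-≡ i a b x ne (inj₂ (e1 , e2)) rewrite ≢⇒≡ᵇ≡false a i (λ e → ne (trans e (sym e2))) = e1

module Arrangement (n : ℕ) (w : List ℕ) (hw : All (λ p → suc p < n) w)
           (hc : ∀ i j → i < n → j < n → i ≢ j → count (isPair i j) (crossings n w) ≡ 1) where
  open Permutation n

  N : ℕ
  N = length w
  state : ℕ → List ℕ
  state t = stateAt n w t
  W : ℕ → ℕ
  W t = at w t

  suc-W<n : ∀ t → t < N → suc (W t) < n
  suc-W<n t h = All-at w t hw h

  W<n : ∀ t → t < N → W t < n
  W<n t h = <-trans (n<1+n (W t)) (suc-W<n t h)

  state-suc : ∀ t → t < N → state (suc t) ≡ swapAt (W t) (state t)
  state-suc t h = foldl-take-suc (λ s p → swapAt p s) (upTo n) w t h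

  state-suc-after : ∀ t → N ≤ t → state (suc t) ≡ state t
  state-suc-after t h = cong (foldl (λ s p → swapAt p s) (upTo n)) (trans (take-all (suc t) w (≤-trans h (n≤1+n t))) (sym (take-all t w h)))

  state-isPermutation : ∀ t → IsPermutation (state t)
  state-isPermutation zero = upTo-isPermutation
  state-isPermutation (suc t) with t <? N
  ... | yes h = subst IsPermutation (sym (state-suc t h)) (swapAt-isPermutation (W t) (state t) (suc-W<n t h) (state-isPermutation t))
  ... | no h = subst IsPermutation (sym (state-suc-after t (≮⇒≥ h))) (state-isPermutation t)

  length-state : ∀ t → length (state t) ≡ n
  length-state t = proj₁ (state-isPermutation t)

  state-<n : ∀ t q → q < n → at (state t) q < n
  state-<n t = proj₁ (proj₂ (state-isPermutation t))

  state-injective : ∀ t q q' → q < n → q' < n → at (state t) q ≡ at (state t) q' → q ≡ q'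
  state-injective t = proj₁ (proj₂ (proj₂ (state-isPermutation t)))

  state-surjective : ∀ t x → x < n → ∃ λ q → q < n × at (state t) q ≡ x
  state-surjective t = proj₂ (proj₂ (proj₂ (state-isPermutation t)))

  state-step-other : ∀ t q → t < N → q ≢ W t → q ≢ suc (W t) → at (state (suc t)) q ≡ at (state t) q
  state-step-other t q h n1 n2 = trans (cong (λ z → at z q) (state-suc t h)) (at-swapAt-other (W t) (state t) q n1 n2)

  state-step-lower : ∀ t → t < N → at (state (suc t)) (W t) ≡ at (state t) (suc (W t))
  state-step-lower t h = trans (cong (λ z → at z (W t)) (state-suc t h)) (at-swapAt-left (W t) (state t) (subst (suc (W t) <_) (sym (length-state t)) (suc-W<n t h)))

  state-step-upper : ∀ t → t < N → at (state (suc t)) (suc (W t)) ≡ at (state t) (W t)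
  state-step-upper t h = trans (cong (λ z → at z (suc (W t))) (state-suc t h)) (at-swapAt-right (W t) (state t) (subst (suc (W t) <_) (sym (length-state t)) (suc-W<n t h)))

  data Involves (t x : ℕ) : Set where
    at-lower : at (state t) (W t) ≡ x → Involves t x
    at-upper : at (state t) (suc (W t)) ≡ x → Involves t x

  data Cross (t a b : ℕ) : Set where
    lower-upper : at (state t) (W t) ≡ a → at (state t) (suc (W t)) ≡ b → Cross t a b
    upper-lower : at (state t) (W t) ≡ b → at (state t) (suc (W t)) ≡ a → Cross t a b

  cross-sym : ∀ {t a b} → Cross t a b → Cross t b a
  cross-sym (lower-upper e1 e2) = upper-lower e1 e2
  cross-sym (upper-lower e1 e2) = lower-upper e1 e2

  cross-involves₁ : ∀ {t a b} → Cross t a b → Involves t a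
  cross-involves₁ (lower-upper e1 e2) = at-lower e1
  cross-involves₁ (upper-lower e1 e2) = at-upper e2

  cross-involves₂ : ∀ {t a b} → Cross t a b → Involves t b
  cross-involves₂ c = cross-involves₁ (cross-sym c)

  crossing-lines-≢ : ∀ t → t < N → at (state t) (W t) ≢ at (state t) (suc (W t))
  crossing-lines-≢ t h e = <-irrefl (state-injective t _ _ (W<n t h) (suc-W<n t h) e) (n<1+n (W t))

  cross-≢ : ∀ {t a b} → t < N → Cross t a b → a ≢ b
  cross-≢ {t} h (lower-upper e1 e2) e = crossing-lines-≢ t h (trans e1 (trans e (sym e2)))
  cross-≢ {t} h (upper-lower e1 e2) e = crossing-lines-≢ t h (trans e1 (trans (sym e) (sym e2)))

  involves-<n : ∀ {t x} → t < N → Involves t x → x < n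
  involves-<n {t} h (at-lower e) = subst (_< n) e (state-<n t _ (W<n t h))
  involves-<n {t} h (at-upper e) = subst (_< n) e (state-<n t _ (suc-W<n t h))

  involves⇒cross : ∀ {t x} → t < N → Involves t x → Cross t x (other x (crossingAt n w t))
  involves⇒cross {t} {x} h (at-lower e) = lower-upper e (sym (other-≡ x _ _ _ (crossing-lines-≢ t h) (inj₁ (e , refl))))
  involves⇒cross {t} {x} h (at-upper e) = upper-lower (sym (other-≡ x _ _ _ (crossing-lines-≢ t h) (inj₂ (refl , e)))) e

  cross-other : ∀ {t x y} → t < N → Cross t x y → other x (crossingAt n w t) ≡ y
  cross-other {t} h (lower-upper e1 e2) = other-≡ _ _ _ _ (crossing-lines-≢ t h) (inj₁ (e1 , e2))
  cross-other {t} h (upper-lower e1 e2) = other-≡ _ _ _ _ (crossing-lines-≢ t h) (inj₂ (e1 , e2))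

  involves⇒true : ∀ {t x} → Involves t x → involves x (crossingAt n w t) ≡ true
  involves⇒true {t} {x} (at-lower e) = involves-true x (at (state t) (W t)) (at (state t) (suc (W t))) (inj₁ e)
  involves⇒true {t} {x} (at-upper e) = involves-true x (at (state t) (W t)) (at (state t) (suc (W t))) (inj₂ e)

  true⇒involves : ∀ {t x} → involves x (crossingAt n w t) ≡ true → Involves t x
  true⇒involves {t} {x} e with involves-sound x (at (state t) (W t)) (at (state t) (suc (W t))) e
  ... | inj₁ e' = at-lower e'
  ... | inj₂ e' = at-upper e'

  cross⇒isPair : ∀ {t a b} → Cross t a b → isPair a b (crossingAt n w t) ≡ true
  cross⇒isPair {t} {a} {b} (lower-upper e1 e2) = isPair-true a b (at (state t) (W t)) (at (state t) (suc (W t))) (inj₁ (e1 , e2))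
  cross⇒isPair {t} {a} {b} (upper-lower e1 e2) = isPair-true a b (at (state t) (W t)) (at (state t) (suc (W t))) (inj₂ (e1 , e2))

  isPair⇒cross : ∀ {t a b} → isPair a b (crossingAt n w t) ≡ true → Cross t a b
  isPair⇒cross {t} {a} {b} e with isPair-sound a b (at (state t) (W t)) (at (state t) (suc (W t))) e
  ... | inj₁ (e1 , e2) = lower-upper e1 e2
  ... | inj₂ (e1 , e2) = upper-lower e1 e2

  count-pair≡1 : ∀ a b → a < n → b < n → a ≢ b → count (isPair a b) (map (crossingAt n w) (range 0 N)) ≡ 1
  count-pair≡1 a b ha hb ne = subst (λ z → count (isPair a b) (map (crossingAt n w) z) ≡ 1) (upTo-range N) (hc a b ha hb ne)

  cross-exists : ∀ a b → a < n → b < n → a ≢ b → ∃ λ t → t < N × Cross t a b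
  cross-exists a b ha hb ne with count≥1⇒some (isPair a b) (crossingAt n w) 0 N (≤-reflexive (sym (count-pair≡1 a b ha hb ne)))
  ... | t , _ , h , e = t , h , isPair⇒cross e

  cross-unique : ∀ {t t' a b} → t < N → t' < N → Cross t a b → Cross t' a b → t ≡ t'
  cross-unique {t} {t'} {a} {b} h h' c c' =
    count≡1⇒unique (isPair a b) (crossingAt n w) 0 N (count-pair≡1 a b ra rb (cross-≢ h c)) t t' z≤n h z≤n h' (cross⇒isPair c) (cross⇒isPair c')
    where ra = involves-<n h (cross-involves₁ c)
          rb = involves-<n h (cross-involves₂ c)

  involves-position : ∀ {t x q} → t < N → q < n → at (state t) q ≡ x → Involves t x → q ≡ W t ⊎ q ≡ suc (W t)
  involves-position {t} h hq e (at-lower e') = inj₁ (state-injective t _ _ hq (W<n t h) (trans e (sym e')))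
  involves-position {t} h hq e (at-upper e') = inj₂ (state-injective t _ _ hq (suc-W<n t h) (trans e (sym e')))

  stays-step : ∀ {t x q} → t < N → q < n → at (state t) q ≡ x → (Involves t x → ⊥) → at (state (suc t)) q ≡ x
  stays-step {t} {x} {q} h hq e ni = trans (state-step-other t q h (λ e' → ni (at-lower (trans (cong (at (state t)) (sym e')) e)))
                                                  (λ e' → ni (at-upper (trans (cong (at (state t)) (sym e')) e)))) e

  stays : ∀ t d q x → t + d ≤ N → q < n → at (state t) q ≡ x → (∀ u → t ≤ u → u < t + d → Involves u x → ⊥) → at (state (t + d)) q ≡ x
  stays t zero q x h hq e ni = subst (λ z → at (state z) q ≡ x) (sym (+-identityʳ t)) e
  stays t (suc d) q x h hq e ni = subst (λ z → at (state z) q ≡ x) (sym (+-suc t d))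
    (stays (suc t) d q x (subst (_≤ N) (+-suc t d) h) hq
      (stays-step (≤-trans (s≤s (m≤m+n t d)) (subst (_≤ N) (+-suc t d) h)) hq e (ni t ≤-refl (m<m+n t (s≤s z≤n))))
      (λ u h1 h2 → ni u (≤-trans (n≤1+n t) h1) (subst (u <_) (sym (+-suc t d)) h2)))

  ¬involves : ∀ {t x q} → t < N → q < n → at (state t) q ≡ x → q ≢ W t → q ≢ suc (W t) → Involves t x → ⊥
  ¬involves h hq e n1 n2 i with involves-position h hq e i
  ... | inj₁ e' = n1 e'
  ... | inj₂ e' = n2 e'

  data Below (t a b : ℕ) : Set where
    below : ∀ qa qb → qa < qb → qb < n → at (state t) qa ≡ a → at (state t) qb ≡ b → Below t a b

  below-asym : ∀ {t a b} → Below t a b → Below t b a → ⊥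
  below-asym {t} (below qa qb lt hb ea eb) (below qb' qa' lt' ha' eb' ea') =
    <-irrefl refl (<-trans lt (subst₂ _<_ (sym e2) (sym e1) lt'))
    where e1 : qa ≡ qa'
          e1 = state-injective t qa qa' (<-trans lt hb) ha' (trans ea (sym ea'))
          e2 : qb ≡ qb'
          e2 = state-injective t qb qb' hb (<-trans lt' ha') (trans eb (sym eb'))

  below-dist : ∀ {t a b} → Below t a b → a ≢ b
  below-dist {t} (below qa qb lt hb ea eb) e = <-irrefl (state-injective t qa qb (<-trans lt hb) hb (trans ea (trans e (sym eb)))) lt

  below-<n₁ : ∀ {t a b} → Below t a b → a < n
  below-<n₁ {t} (below qa qb lt hb ea eb) = subst (_< n) ea (state-<n t qa (<-trans lt hb))

  below-<n₂ : ∀ {t a b} → Below t a b → b < n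
  below-<n₂ {t} (below qa qb lt hb ea eb) = subst (_< n) eb (state-<n t qb hb)

  below-total : ∀ t a b → a < n → b < n → a ≢ b → Below t a b ⊎ Below t b a
  below-total t a b ha hb ne with state-surjective t a ha | state-surjective t b hb
  ... | qa , ha' , ea | qb , hb' , eb with <-cmp qa qb
  ... | tri< lt _ _ = inj₁ (below qa qb lt hb' ea eb)
  ... | tri≈ _ e _ = ⊥-elim (ne (trans (sym ea) (trans (cong (at (state t)) e) eb)))
  ... | tri> _ _ gt = inj₂ (below qb qa gt ha' eb ea)

  ¬below⇒below : ∀ t a b → a ≢ b → a < n → b < n → (Below t a b → ⊥) → Below t b a
  ¬below⇒below t a b ne ha hb nb with below-total t a b ha hb ne
  ... | inj₁ B = ⊥-elim (nb B)
  ... | inj₂ B = B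

  below-step : ∀ {t a b} → t < N → (Cross t a b → ⊥) → Below t a b → Below (suc t) a b
  below-step {t} {a} {b} h nc (below qa qb lt hb ea eb) with swapCase (W t) qa | swapCase (W t) qb
  ... | atLeft refl | atLeft refl = ⊥-elim (<-irrefl refl lt)
  ... | atLeft refl | atRight refl = ⊥-elim (nc (lower-upper ea eb))
  ... | atLeft refl | elsewhere n1 n2 = below (suc (W t)) qb (≤∧≢⇒< lt (λ e → n2 (sym e))) hb (trans (state-step-upper t h) ea) (trans (state-step-other t qb h n1 n2) eb)
  ... | atRight refl | atLeft e = ⊥-elim (<-irrefl refl (<-trans (subst (_< qb) refl lt) (subst (_< suc (W t)) (sym e) (n<1+n (W t)))))
  ... | atRight refl | atRight e = ⊥-elim (<-irrefl (sym e) lt)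
  ... | atRight refl | elsewhere n1 n2 = below (W t) qb (<-trans (n<1+n (W t)) lt) hb (trans (state-step-lower t h) ea) (trans (state-step-other t qb h n1 n2) eb)
  ... | elsewhere n1 n2 | atLeft refl = below qa (suc (W t)) (<-trans lt (n<1+n (W t))) (suc-W<n t h) (trans (state-step-other t qa h n1 n2) ea) (trans (state-step-upper t h) eb)
  ... | elsewhere n1 n2 | atRight refl = below qa (W t) (≤∧≢⇒< (≤-pred lt) n1) (W<n t h) (trans (state-step-other t qa h n1 n2) ea) (trans (state-step-lower t h) eb)
  ... | elsewhere n1 n2 | elsewhere m1 m2 = below qa qb lt hb (trans (state-step-other t qa h n1 n2) ea) (trans (state-step-other t qb h m1 m2) eb)

  below-back : ∀ {t a b} → t < N → (Cross t a b → ⊥) → Below (suc t) a b → Below t a b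
  below-back {t} {a} {b} h nc B with below-total t a b (below-<n₁ B) (below-<n₂ B) (below-dist B)
  ... | inj₁ B' = B'
  ... | inj₂ B' = ⊥-elim (below-asym B (below-step h (λ c → nc (cross-sym c)) B'))

  below-forward : ∀ {a b} t d → t + d ≤ N → (∀ u → t ≤ u → u < t + d → Cross u a b → ⊥) → Below t a b → Below (t + d) a b
  below-forward t zero h nc B = subst (λ z → Below z _ _) (sym (+-identityʳ t)) B
  below-forward {a} {b} t (suc d) h nc B = subst (λ z → Below z a b) (sym (+-suc t d))
    (below-forward (suc t) d (subst (_≤ N) (+-suc t d) h)
      (λ u h1 h2 → nc u (≤-trans (n≤1+n t) h1) (subst (u <_) (sym (+-suc t d)) h2))
      (below-step (≤-trans (s≤s (m≤m+n t d)) (subst (_≤ N) (+-suc t d) h)) (nc t ≤-refl (m<m+n t (s≤s z≤n))) B))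

  below-backward : ∀ {a b} t d → t + d ≤ N → (∀ u → t ≤ u → u < t + d → Cross u a b → ⊥) → Below (t + d) a b → Below t a b
  below-backward t zero h nc B = subst (λ z → Below z _ _) (+-identityʳ t) B
  below-backward {a} {b} t (suc d) h nc B =
    below-back (≤-trans (s≤s (m≤m+n t d)) (subst (_≤ N) (+-suc t d) h)) (nc t ≤-refl (m<m+n t (s≤s z≤n)))
      (below-backward (suc t) d (subst (_≤ N) (+-suc t d) h)
        (λ u h1 h2 → nc u (≤-trans (n≤1+n t) h1) (subst (u <_) (sym (+-suc t d)) h2))
        (subst (λ z → Below z a b) (+-suc t d) B))

  below-move : ∀ {a b} t t' → t ≤ N → t' ≤ N →
    (∀ u → u < N → Cross u a b → (u < t × u < t') ⊎ (t ≤ u × t' ≤ u)) → Below t a b → Below t' a b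
  below-move {a} {b} t t' h h' hyp B with ≤-total t t'
  ... | inj₁ le = subst (λ z → Below z a b) (m+[n∸m]≡n le)
      (below-forward t (t' ∸ t) (subst (_≤ N) (sym (m+[n∸m]≡n le)) h')
        (λ u h1 h2 c → bad u h1 (subst (u <_) (m+[n∸m]≡n le) h2) c) B)
    where bad : ∀ u → t ≤ u → u < t' → Cross u a b → ⊥
          bad u h1 h2 c with hyp u (<-≤-trans h2 h') c
          ... | inj₁ (x , _) = <-irrefl refl (<-≤-trans x h1)
          ... | inj₂ (_ , y) = <-irrefl refl (<-≤-trans h2 y)
  ... | inj₂ le = below-backward t' (t ∸ t') (subst (_≤ N) (sym (m+[n∸m]≡n le)) h)
        (λ u h1 h2 c → bad u h1 (subst (u <_) (m+[n∸m]≡n le) h2) c)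
        (subst (λ z → Below z a b) (sym (m+[n∸m]≡n le)) B)
    where bad : ∀ u → t' ≤ u → u < t → Cross u a b → ⊥
          bad u h1 h2 c with hyp u (<-≤-trans h2 h) c
          ... | inj₁ (_ , y) = <-irrefl refl (<-≤-trans y h1)
          ... | inj₂ (y , _) = <-irrefl refl (<-≤-trans h2 y)

  below-before-cross : ∀ {a b c t t'} → c < N → Cross c a b → t ≤ c → t' ≤ c → Below t a b → Below t' a b
  below-before-cross {a} {b} {c} {t} {t'} count-pair≡1 cc h1 h2 =
    below-move t t' (≤-trans h1 (<⇒≤ count-pair≡1)) (≤-trans h2 (<⇒≤ count-pair≡1))
      (λ u hu cu → inj₂ (subst (t ≤_) (cross-unique count-pair≡1 hu cc cu) h1 , subst (t' ≤_) (cross-unique count-pair≡1 hu cc cu) h2))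

  below-after-cross : ∀ {a b c t t'} → c < N → Cross c a b → c < t → c < t' → t ≤ N → t' ≤ N → Below t a b → Below t' a b
  below-after-cross {a} {b} {c} {t} {t'} count-pair≡1 cc h1 h2 h3 h4 =
    below-move t t' h3 h4
      (λ u hu cu → inj₁ (subst (_< t) (cross-unique count-pair≡1 hu cc cu) h1 , subst (_< t') (cross-unique count-pair≡1 hu cc cu) h2))

  AdjacentAt : ℕ → ℕ → ℕ → ℕ → Set
  AdjacentAt t a b q = suc q < n × at (state t) q ≡ a × at (state t) (suc q) ≡ b

  below-adjacentAt : ∀ {t a b q x} → AdjacentAt t a b q → x ≢ a → x ≢ b → Below t x a → Below t x b
  below-adjacentAt {t} {a} {b} {q} (hq , ea , eb) n1 n2 (below qx qa lt hb ex ea') =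
    below qx (suc q) (<-trans (subst (qx <_) e lt) (n<1+n q)) hq ex eb
    where e : qa ≡ q
          e = state-injective t qa q hb (<-trans (n<1+n q) hq) (trans ea' (sym ea))

  below-adjacentAt′ : ∀ {t a b q x} → AdjacentAt t a b q → x ≢ a → x ≢ b → Below t x b → Below t x a
  below-adjacentAt′ {t} {a} {b} {q} (hq , ea , eb) n1 n2 (below qx qb lt hb ex eb') =
    below qx q (≤∧≢⇒< (≤-pred (subst (qx <_) e lt)) (λ e' → n1 (trans (sym ex) (trans (cong (at (state t)) e') ea)))) (<-trans (n<1+n q) hq) ex ea
    where e : qb ≡ suc q
          e = state-injective t qb (suc q) hb hq (trans eb' (sym eb))

  data Adjacent (t a b : ℕ) : Set where
    adjacent-lu : ∀ q → AdjacentAt t a b q → Adjacent t a b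
    adjacent-ul : ∀ q → AdjacentAt t b a q → Adjacent t a b

  cross⇒adjacent : ∀ {c a b} → c < N → Cross c a b → Adjacent c a b
  cross⇒adjacent {c} h (lower-upper e1 e2) = adjacent-lu (W c) (suc-W<n c h , e1 , e2)
  cross⇒adjacent {c} h (upper-lower e1 e2) = adjacent-ul (W c) (suc-W<n c h , e1 , e2)

  below-adjacent : ∀ {t a b x} → Adjacent t a b → x ≢ a → x ≢ b → Below t x a → Below t x b
  below-adjacent (adjacent-lu q P) n1 n2 = below-adjacentAt P n1 n2
  below-adjacent (adjacent-ul q P) n1 n2 = below-adjacentAt′ P n2 n1

  adjacent-sym : ∀ {t a b} → Adjacent t a b → Adjacent t b a
  adjacent-sym (adjacent-lu q P) = adjacent-ul q P
  adjacent-sym (adjacent-ul q P) = adjacent-lu q P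

  cross-lower : ∀ {c a b} → c < N → Cross c a b → at (state c) (suc (W c)) ≡ a → at (state c) (W c) ≡ b
  cross-lower h (lower-upper e1 e2) e = ⊥-elim (cross-≢ h (lower-upper e1 e2) (trans (sym e) e2))
  cross-lower h (upper-lower e1 e2) e = e1

  cross-upper : ∀ {c a b} → c < N → Cross c a b → at (state c) (W c) ≡ a → at (state c) (suc (W c)) ≡ b
  cross-upper h (lower-upper e1 e2) e = e2
  cross-upper h (upper-lower e1 e2) e = ⊥-elim (cross-≢ h (upper-lower e1 e2) (trans (sym e) e1))

  stays-between : ∀ τ τ' q y → τ' ≤ N → q < n → at (state (suc τ)) q ≡ y →
    (∀ u → τ < u → u < τ' → Involves u y → ⊥) → ∀ t → τ < t → t ≤ τ' → at (state t) q ≡ y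
  stays-between τ τ' q y hN hq e ni t h1 h2 =
    subst (λ z → at (state z) q ≡ y) (m+[n∸m]≡n h1)
      (stays (suc τ) (t ∸ suc τ) q y (subst (_≤ N) (sym (m+[n∸m]≡n h1)) (≤-trans h2 hN)) hq e
        (λ u u1 u2 → ni u u1 (<-≤-trans (subst (u <_) (m+[n∸m]≡n h1) u2) h2)))

  position-constant : ∀ τ τ' q → τ' ≤ N → (∀ u → τ < u → u < τ' → (q ≢ W u) × (q ≢ suc (W u))) →
    ∀ t → τ < t → t ≤ τ' → at (state t) q ≡ at (state (suc τ)) q
  position-constant τ τ' q hN hyp (suc t) h1 h2 with m<1+n⇒m<n∨m≡n h1
  ... | inj₂ refl = refl
  ... | inj₁ lt = trans (state-step-other t q (<-≤-trans h2 hN) (proj₁ (hyp t lt h2)) (proj₂ (hyp t lt h2))) (position-constant τ τ' q hN hyp t lt (<⇒≤ h2))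

module Rows (n : ℕ) (w : List ℕ) (hw : All (λ p → suc p < n) w)
           (hc : ∀ i j → i < n → j < n → i ≢ j → count (isPair i j) (crossings n w) ≡ 1) where
  open Arrangement n w hw hc

  O≡filter : ∀ x → O n w x ≡ map (λ t → other x (crossingAt n w t)) (filter (λ t → T? (involves x (crossingAt n w t))) (range 0 N))
  O≡filter x = begin
    map (other x) (filter (λ c → T? (involves x c)) (map (crossingAt n w) (upTo N)))
      ≡⟨ cong (λ z → map (other x) (filter (λ c → T? (involves x c)) (map (crossingAt n w) z))) (upTo-range N) ⟩
    map (other x) (filter (λ c → T? (involves x c)) (map (crossingAt n w) (range 0 N)))
      ≡⟨ cong (map (other x)) (filter-map-T (involves x) (crossingAt n w) (range 0 N)) ⟩
    map (other x) (map (crossingAt n w) (filter (λ t → T? (involves x (crossingAt n w t))) (range 0 N)))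
      ≡⟨ sym (map-∘ (filter (λ t → T? (involves x (crossingAt n w t))) (range 0 N))) ⟩
    map (λ t → other x (crossingAt n w t)) (filter (λ t → T? (involves x (crossingAt n w t))) (range 0 N)) ∎

  adjacentIn⇒consecutive : ∀ x a c → AdjacentIn (O n w x) a c →
    Σ ℕ λ θ1 → Σ ℕ λ θ2 → θ1 < θ2 × θ2 < N ×
      ((Cross θ1 x a × Cross θ2 x c) ⊎ (Cross θ1 x c × Cross θ2 x a)) ×
      (∀ t → θ1 < t → t < θ2 → Involves t x → ⊥)
  adjacentIn⇒consecutive x a c (xs , ys , inj₁ e) with AdjacentInFilter.adjacentIn-elim (λ t → involves x (crossingAt n w t)) (λ t → other x (crossingAt n w t)) N xs a c ys (trans (sym (O≡filter x)) e)
  ... | θ1 , θ2 , lt , hN , b1 , b2 , gp , e1 , e2 =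
    θ1 , θ2 , lt , hN ,
    inj₁ (subst (Cross θ1 x) e1 (involves⇒cross (<-trans lt hN) (true⇒involves b1)) , subst (Cross θ2 x) e2 (involves⇒cross hN (true⇒involves b2))) ,
    (λ t h1 h2 i → gp t h1 h2 (involves⇒true i))
  adjacentIn⇒consecutive x a c (xs , ys , inj₂ e) with AdjacentInFilter.adjacentIn-elim (λ t → involves x (crossingAt n w t)) (λ t → other x (crossingAt n w t)) N xs c a ys (trans (sym (O≡filter x)) e)
  ... | θ1 , θ2 , lt , hN , b1 , b2 , gp , e1 , e2 =
    θ1 , θ2 , lt , hN ,
    inj₂ (subst (Cross θ1 x) e1 (involves⇒cross (<-trans lt hN) (true⇒involves b1)) , subst (Cross θ2 x) e2 (involves⇒cross hN (true⇒involves b2))) ,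
    (λ t h1 h2 i → gp t h1 h2 (involves⇒true i))

  ¬adjacentIn-self : ∀ x a → AdjacentIn (O n w x) a a → ⊥
  ¬adjacentIn-self x a A with adjacentIn⇒consecutive x a a A
  ... | θ1 , θ2 , lt , hN , inj₁ (c1 , c2) , _ = <-irrefl (cross-unique (<-trans lt hN) hN c1 c2) lt
  ... | θ1 , θ2 , lt , hN , inj₂ (c1 , c2) , _ = <-irrefl (cross-unique (<-trans lt hN) hN c1 c2) lt

  consecutive⇒adjacentIn : ∀ x a c θ1 θ2 → θ1 < θ2 → θ2 < N → Cross θ1 x a → Cross θ2 x c →
    (∀ t → θ1 < t → t < θ2 → Involves t x → ⊥) → AdjacentIn (O n w x) a c
  consecutive⇒adjacentIn x a c θ1 θ2 lt hN c1 c2 gp with AdjacentInFilter.adjacentIn-intro (λ t → involves x (crossingAt n w t)) (λ t → other x (crossingAt n w t)) N θ1 θ2 lt hN (involves⇒true (cross-involves₁ c1)) (involves⇒true (cross-involves₁ c2)) (λ t h1 h2 b → gp t h1 h2 (true⇒involves b))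
  ... | xs , ys , e = xs , ys , inj₁ (trans (O≡filter x) (subst₂ (λ z1 z2 → _ ≡ xs ++ z1 ∷ z2 ∷ ys) (cross-other (<-trans lt hN) c1) (cross-other hN c2) e))

  cross-functional : ∀ {v a b c} → v < N → Cross v a b → Cross v a c → b ≡ c
  cross-functional h (lower-upper e1 e2) (lower-upper f1 f2) = trans (sym e2) f2
  cross-functional {v} h (lower-upper e1 e2) (upper-lower f1 f2) = ⊥-elim (crossing-lines-≢ v h (trans e1 (sym f2)))
  cross-functional {v} h (upper-lower e1 e2) (lower-upper f1 f2) = ⊥-elim (crossing-lines-≢ v h (trans f1 (sym e2)))
  cross-functional h (upper-lower e1 e2) (upper-lower f1 f2) = trans (sym e1) f1

AdjacentTriple : ℕ → List ℕ → ℕ × ℕ × ℕ → Set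
AdjacentTriple n w (a , b , c) = AdjacentIn (O n w b) a c

adjacentTriple-flip : ∀ n w {a b c} → AdjacentTriple n w (a , b , c) → AdjacentTriple n w (c , b , a)
adjacentTriple-flip n w (xs , ys , inj₁ e) = xs , ys , inj₂ e
adjacentTriple-flip n w (xs , ys , inj₂ e) = xs , ys , inj₁ e

-- From a bounded face to adjacent triples

module FaceBoundary (n : ℕ) (w : List ℕ) (hw : All (λ p → suc p < n) w)
           (hc : ∀ i j → i < n → j < n → i ≢ j → count (isPair i j) (crossings n w) ≡ 1)
           (t1 t2 : ℕ) (face : IsBoundedFace n w t1 t2) where
  open Arrangement n w hw hc
  open Rows n w hw hc
  open CyclicTriples (AdjacentTriple n w)

  h12 : t1 < t2
  h12 = proj₁ face
  h2N : t2 < N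
  h2N = proj₁ (proj₂ face)
  noP : ∀ t → t1 < t → t < t2 → W t ≢ W t1
  noP = proj₂ (proj₂ (proj₂ face))

  p : ℕ
  p = W t1
  t1N : t1 < N
  t1N = <-trans h12 h2N
  pn : suc p < n
  pn = suc-W<n t1 t1N
  p<n : p < n
  p<n = <-trans (n<1+n p) pn
  W2 : W t2 ≡ p
  W2 = sym (proj₁ (proj₂ (proj₂ face)))

  -- The lines occupying position q during (t1, t2]; b flags the crossings that replace them.
  module Side (q : ℕ) (b : ℕ → Bool) (qn : q < n)
     (hb : ∀ u → t1 < u → u < t2 → b u ≡ false → (q ≢ W u) × (q ≢ suc (W u))) where
    open Enumeration b
    Λ : List ℕ
    Λ = filter (λ t → T? (b t)) (between t1 t2)
    gapΛ : Enumerates (suc t1) t2 Λ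
    gapΛ = subst (λ z → Enumerates (suc t1) z Λ) (m+[n∸m]≡n h12)
             (subst (Enumerates (suc t1) (suc t1 + (t2 ∸ suc t1))) (cong (filter (λ t → T? (b t))) (sym (between-range t1 t2)))
               (filter-enumerates (suc t1) (t2 ∸ suc t1)))
    a : ℕ
    a = length Λ
    G : ℕ → ℕ
    G i = at (t1 ∷ Λ ++ [ t2 ]) i
    seqG : ∀ i → i ≤ a → G i < G (suc i) × (∀ t → G i < t → t < G (suc i) → b t ≡ true → ⊥)
    seqG = enumerates-consecutive t1 t2 Λ gapΛ
    Ga : G (suc a) ≡ t2
    Ga = trans (cong (at (Λ ++ [ t2 ])) (sym (+-identityʳ a))) (at-++ʳ Λ [ t2 ] 0)
    Gs : ∀ i → i < a → G (suc i) ≡ at Λ i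
    Gs i h = at-++ˡ Λ [ t2 ] i h
    Gb : ∀ i → i < a → b (G (suc i)) ≡ true
    Gb i h = subst (λ z → b z ≡ true) (sym (Gs i h)) (enumerates-true (suc t1) t2 Λ gapΛ i h)
    lowb : ∀ i → i ≤ suc a → t1 ≤ G i
    lowb zero _ = ≤-refl
    lowb (suc i) h = ≤-trans (lowb i (≤-trans (n≤1+n i) h)) (<⇒≤ (proj₁ (seqG i (≤-pred h))))
    upb' : ∀ d i → d + i ≡ suc a → G i ≤ t2
    upb' zero i e = ≤-reflexive (trans (cong G e) Ga)
    upb' (suc d) i e = ≤-trans (<⇒≤ (proj₁ (seqG i (≤-pred (subst (suc i ≤_) e (≤-trans (s≤s (m≤n+m i d)) ≤-refl)))))) (upb' d (suc i) (trans (+-suc d i) e))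
    upb : ∀ i → i ≤ suc a → G i ≤ t2
    upb i h = upb' (suc a ∸ i) i (m∸n+n≡m h)
    line : ℕ → ℕ
    line i = at (state (suc (G i))) q
    untouched : ∀ i → i ≤ a → ∀ u → G i < u → u < G (suc i) → (q ≢ W u) × (q ≢ suc (W u))
    untouched i h u h1 h2 with b u in e
    ... | true = ⊥-elim (proj₂ (seqG i h) u h1 h2 e)
    ... | false = hb u (≤-<-trans (lowb i (≤-trans h (n≤1+n a))) h1) (<-≤-trans h2 (upb (suc i) (s≤s h))) e
    seg : ∀ i → i ≤ a → ∀ t → G i < t → t ≤ G (suc i) → at (state t) q ≡ line i
    seg i h = position-constant (G i) (G (suc i)) q (≤-trans (upb (suc i) (s≤s h)) (<⇒≤ h2N)) (untouched i h)
    notInv : ∀ i → i ≤ a → ∀ t → G i < t → t < G (suc i) → Involves t (line i) → ⊥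
    notInv i h t h1 h2 = ¬involves (<-≤-trans h2 (≤-trans (upb (suc i) (s≤s h)) (<⇒≤ h2N))) qn (seg i h t h1 (<⇒≤ h2))
      (proj₁ (untouched i h t h1 h2)) (proj₂ (untouched i h t h1 h2))
    chainL : List ℕ
    chainL = at (state (suc t1)) q ∷ map (λ t → at (state (suc t)) q) Λ
    at-chain : ∀ i → i ≤ a → at chainL i ≡ line i
    at-chain zero _ = refl
    at-chain (suc i) h = trans (at-map (λ t → at (state (suc t)) q) Λ i h) (cong (λ z → at (state (suc z)) q) (sym (Gs i h)))
    len-chain : length chainL ≡ suc a
    len-chain = cong suc (length-map (λ t → at (state (suc t)) q) Λ)
    endL : at (state t2) q ≡ line a
    endL = seg a ≤-refl t2 (subst (G a <_) Ga (proj₁ (seqG a ≤-refl))) (≤-reflexive (sym Ga))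

    module Triples (X Y : ℕ) (c0 : Cross (G 0) (line 0) X)
                (cs : ∀ i → i < a → Cross (G (suc i)) (line (suc i)) (line i))
                (ca : Cross (G (suc a)) (line a) Y) where
      E : List ℕ
      E = X ∷ chainL ++ [ Y ]
      at-E-mid : ∀ i → i ≤ a → at E (suc i) ≡ line i
      at-E-mid i h = trans (at-++ˡ chainL [ Y ] i (subst (i <_) (sym len-chain) (s≤s h))) (at-chain i h)
      at-E-end : at E (suc (suc a)) ≡ Y
      at-E-end = trans (cong (at (chainL ++ [ Y ])) (trans (sym (+-identityʳ (suc a))) (cong (_+ 0) (sym len-chain)))) (at-++ʳ chainL [ Y ] 0)
      len-E : length E ≡ suc (suc (suc a))
      len-E = cong suc (trans (length-++ chainL) (trans (cong (_+ 1) len-chain) (+-comm (suc a) 1)))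
      GN : ∀ i → i ≤ suc a → G i < N
      GN i h = ≤-<-trans (upb i h) h2N
      cross1 : ∀ j → j ≤ a → Cross (G j) (line j) (at E j)
      cross1 zero _ = c0
      cross1 (suc j) h = subst (Cross (G (suc j)) (line (suc j))) (sym (at-E-mid j (≤-trans (n≤1+n j) h))) (cs j h)
      cross2 : ∀ j → j ≤ a → Cross (G (suc j)) (line j) (at E (2 + j))
      cross2 j h with m≤n⇒m<n∨m≡n h
      ... | inj₁ lt = subst (Cross (G (suc j)) (line j)) (sym (at-E-mid (suc j) lt)) (cross-sym (cs j lt))
      ... | inj₂ refl = subst (Cross (G (suc j)) (line j)) (sym at-E-end) ca
      adjE : ∀ j → j ≤ a → AdjacentTriple n w (at E j , at E (1 + j) , at E (2 + j))
      adjE j h = (subst (λ z → AdjacentIn (O n w z) (at E j) (at E (2 + j))) (sym (at-E-mid j h))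
                  (consecutive⇒adjacentIn (line j) (at E j) (at E (2 + j)) (G j) (G (suc j)) (proj₁ (seqG j h)) (GN (suc j) (s≤s h))
                     (cross1 j h) (cross2 j h) (notInv j h)))
      allE : All (AdjacentTriple n w) (windows3 E)
      allE = windows3-from-at E (λ j lt → adjE j (≤-pred (≤-pred (≤-pred (subst (2 + j <_) len-E lt)))))

  bL : ℕ → Bool
  bL t = suc (W t) ≡ᵇ W t1
  bU : ℕ → Bool
  bU t = W t ≡ᵇ suc (W t1)

  hbL : ∀ u → t1 < u → u < t2 → bL u ≡ false → (p ≢ W u) × (p ≢ suc (W u))
  hbL u h1 h2 e = (λ e' → noP u h1 h2 (sym e')) , (λ e' → false≢true (trans (sym e) (≡⇒≡ᵇ≡true _ _ (sym e'))))
  hbU : ∀ u → t1 < u → u < t2 → bU u ≡ false → (suc p ≢ W u) × (suc p ≢ suc (W u))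
  hbU u h1 h2 e = (λ e' → false≢true (trans (sym e) (≡⇒≡ᵇ≡true _ _ (sym e')))) , (λ e' → noP u h1 h2 (sym (suc-injective e')))

  module L = Side p bL p<n hbL
  module U = Side (suc p) bU pn hbU

  crossL0 : Cross t1 (L.line 0) (at (state t1) p)
  crossL0 = upper-lower refl (sym (state-step-lower t1 t1N))

  crossLs : ∀ i → i < L.a → Cross (L.G (suc i)) (L.line (suc i)) (L.line i)
  crossLs i h = lower-upper atW atS
    where
    τ = L.G (suc i)
    hτ : τ < N
    hτ = ≤-<-trans (L.upb (suc i) (s≤s (<⇒≤ h))) h2N
    e : suc (W τ) ≡ p
    e = ≡ᵇ≡true⇒≡ _ _ (L.Gb i h)
    atS : at (state τ) (suc (W τ)) ≡ L.line i
    atS = trans (cong (at (state τ)) e) (L.seg i (<⇒≤ h) τ (proj₁ (L.seqG i (<⇒≤ h))) ≤-refl)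
    atW : at (state τ) (W τ) ≡ L.line (suc i)
    atW = sym (trans (cong (at (state (suc τ))) (sym e)) (state-step-upper τ hτ))

  crossLa : Cross (L.G (suc L.a)) (L.line L.a) (at (state t2) (suc p))
  crossLa = subst (λ z → Cross z (L.line L.a) (at (state t2) (suc p))) (sym L.Ga)
              (lower-upper (trans (cong (at (state t2)) W2) L.endL) (cong (λ z → at (state t2) (suc z)) W2))

  crossU0 : Cross t1 (U.line 0) (at (state t1) (suc p))
  crossU0 = lower-upper (sym (state-step-upper t1 t1N)) refl

  crossUs : ∀ i → i < U.a → Cross (U.G (suc i)) (U.line (suc i)) (U.line i)
  crossUs i h = upper-lower atW atS
    where
    τ = U.G (suc i)
    hτ : τ < N
    hτ = ≤-<-trans (U.upb (suc i) (s≤s (<⇒≤ h))) h2N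
    e : W τ ≡ suc p
    e = ≡ᵇ≡true⇒≡ _ _ (U.Gb i h)
    atW : at (state τ) (W τ) ≡ U.line i
    atW = trans (cong (at (state τ)) e) (U.seg i (<⇒≤ h) τ (proj₁ (U.seqG i (<⇒≤ h))) ≤-refl)
    atS : at (state τ) (suc (W τ)) ≡ U.line (suc i)
    atS = sym (trans (cong (at (state (suc τ))) (sym e)) (state-step-lower τ hτ))

  crossUb : Cross (U.G (suc U.a)) (U.line U.a) (at (state t2) p)
  crossUb = subst (λ z → Cross z (U.line U.a) (at (state t2) p)) (sym U.Ga)
              (upper-lower (cong (at (state t2)) W2) (trans (cong (λ z → at (state t2) (suc z)) W2) U.endL))

  X0 = at (state t1) p
  X1 = at (state t1) (suc p)
  Y0 = at (state t2) (suc p)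
  Y1 = at (state t2) p

  module LA = L.Triples X0 Y0 crossL0 crossLs crossLa
  module UA = U.Triples X1 Y1 crossU0 crossUs crossUb

  lw = take L.a L.chainL
  eLw : L.chainL ≡ lw ++ [ Y1 ]
  eLw = trans (snoc-at L.chainL L.a L.len-chain) (cong (λ z → lw ++ [ z ]) (trans (L.at-chain L.a ≤-refl) (sym L.endL)))
  ru = reverse (take U.a U.chainL)
  eRu : reverse U.chainL ≡ Y0 ∷ ru
  eRu = trans (cong reverse (trans (snoc-at U.chainL U.a U.len-chain) (cong (λ z → take U.a U.chainL ++ [ z ]) (trans (U.at-chain U.a ≤-refl) (sym U.endL)))))
              (rev-snoc (take U.a U.chainL) Y0)

  eX0 : U.line 0 ≡ X0
  eX0 = state-step-upper t1 t1N
  eX1 : L.line 0 ≡ X1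
  eX1 = state-step-lower t1 t1N

  boundary-adjacentTriples : All (AdjacentTriple n w) (cyclicTriples (boundary n w t1 t2))
  boundary-adjacentTriples = subst (λ z → All (AdjacentTriple n w) (windows3 z)) (sym eT0)
           (windows3-++ (X0 ∷ lw) Y1 Y0 (ru ++ [ X1 ]) h1 h2)
    where
    restL = map (λ t → at (state (suc t)) p) L.Λ
    restU = map (λ t → at (state (suc t)) (suc p)) U.Λ
    eT0 : lastOr (L.line 0) (restL ++ reverse U.chainL) ∷ L.line 0 ∷ (restL ++ reverse U.chainL) ++ [ L.line 0 ]
          ≡ (X0 ∷ lw) ++ Y1 ∷ Y0 ∷ (ru ++ [ X1 ])
    eT0 = begin
      lastOr (L.line 0) (restL ++ reverse U.chainL) ∷ (L.chainL ++ reverse U.chainL) ++ [ L.line 0 ]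
        ≡⟨ cong₂ (λ z1 z2 → z1 ∷ (L.chainL ++ reverse U.chainL) ++ [ z2 ]) (trans (lastOr-rev (L.line 0) restL (U.line 0) restU) eX0) eX1 ⟩
      X0 ∷ (L.chainL ++ reverse U.chainL) ++ [ X1 ]
        ≡⟨ cong₂ (λ z1 z2 → X0 ∷ (z1 ++ z2) ++ [ X1 ]) eLw eRu ⟩
      X0 ∷ ((lw ++ [ Y1 ]) ++ Y0 ∷ ru) ++ [ X1 ]
        ≡⟨ cong (X0 ∷_) (trans (++-assoc (lw ++ [ Y1 ]) (Y0 ∷ ru) [ X1 ]) (++-assoc lw [ Y1 ] (Y0 ∷ ru ++ [ X1 ]))) ⟩
      (X0 ∷ lw) ++ Y1 ∷ Y0 ∷ (ru ++ [ X1 ]) ∎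
    h1 : All (AdjacentTriple n w) (windows3 ((X0 ∷ lw) ++ Y1 ∷ Y0 ∷ []))
    h1 = subst (λ z → All (AdjacentTriple n w) (windows3 z)) (cong (X0 ∷_) (trans (cong (_++ [ Y0 ]) eLw) (++-assoc lw [ Y1 ] [ Y0 ]))) LA.allE
    h2 : All (AdjacentTriple n w) (windows3 (Y1 ∷ Y0 ∷ ru ++ [ X1 ]))
    h2 = subst (λ z → All (AdjacentTriple n w) (windows3 z)) (trans (rev-cons-snoc X1 U.chainL Y1) (cong (λ z → Y1 ∷ z ++ [ X1 ]) eRu))
           (windows3-reverse (adjacentTriple-flip n w) UA.E UA.allE)

-- From adjacent triples to a bounded face

module Walks (n : ℕ) (w : List ℕ) (hw : All (λ p → suc p < n) w)
           (hc : ∀ i j → i < n → j < n → i ≢ j → count (isPair i j) (crossings n w) ≡ 1) where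
  open Arrangement n w hw hc

  -- The lines f 1, f 2, … of a cycle meet consecutively at the times g 1, g 2, …, and f 1
  -- and f 2 cross at time t1 = g 1 at position p.  Then f 2, f 3, … take turns at position
  -- p: f (suc m) occupies it during (g m, g (suc m)], having crossed in from position
  -- p - 1 when m ≥ 2, until the first crossing at position p itself.  hSide (the cycle
  -- stays on one side of each of its lines) is what makes the times g m increase.
  module LowerWalk (K : ℕ) (K3 : 3 ≤ K) (f g : ℕ → ℕ) (p t1 : ℕ)
    (hV : ∀ j → j ≤ suc K → g j < N × Cross (g j) (f j) (f (suc j)))
    (hS : ∀ j → j ≤ suc K → ∀ t → Between (g j) (g (suc j)) t → Involves t (f (suc j)) → ⊥)
    (hD : ∀ j → j ≤ suc K → g j ≢ g (suc j))
    (hMin : ∀ j → j ≤ suc K → g 1 ≤ g j)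
    (hPer : g (suc K) ≡ g 1)
    (hSide : ∀ i → i < K → Below (g i) (f (2 + i)) (f (1 + i)) → Below (g (3 + i)) (f (2 + i)) (f (3 + i)))
    (hg1 : g 1 ≡ t1) (hp : W t1 ≡ p)
    (hs1 : at (state t1) p ≡ f 1) (hs2 : at (state t1) (suc p) ≡ f 2)
    where

    record State (i : ℕ) : Set where
      field
        bnd : 2 + i ≤ K
        inc : ∀ m → 1 ≤ m → m ≤ suc i → g m < g (suc m)
        seg : ∀ m → 1 ≤ m → m ≤ suc i → ∀ t → g m < t → t ≤ g (suc m) → at (state t) p ≡ f (suc m)
        low : ∀ m → 2 ≤ m → m ≤ suc i → suc (W (g m)) ≡ p
        first : g 1 < g (2 + i)
        noP : ∀ t → g 1 < t → t < g (2 + i) → W t ≢ p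

    t1N : t1 < N
    t1N = subst (_< N) hg1 (proj₁ (hV 1 (s≤s z≤n)))

    pn : suc p < n
    pn = subst (λ z → suc z < n) hp (suc-W<n t1 t1N)

    k1 : 1 ≤ K
    k1 = ≤-trans (s≤s z≤n) K3

    g12 : g 1 < g 2
    g12 = ≤∧≢⇒< (hMin 2 (s≤s k1)) (hD 1 (s≤s z≤n))

    base : State 0
    base = record
      { bnd = K3'
      ; inc = λ { m h1 h2 → subst (λ z → g z < g (suc z)) (sym (≤-antisym h2 h1)) g12 }
      ; seg = λ { m h1 h2 t u1 u2 → subst (λ z → at (state t) p ≡ f (suc z)) (sym (≤-antisym h2 h1)) (seg1 t (subst (λ z → g z < t) (≤-antisym h2 h1) u1) (subst (λ z → t ≤ g (suc z)) (≤-antisym h2 h1) u2)) }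
      ; low = λ { m h1 h2 → ⊥-elim (<-irrefl refl (≤-trans h1 h2)) }
      ; first = g12
      ; noP = λ t u1 u2 e → hS 1 (s≤s z≤n) t (inj₁ (u1 , u2)) (at-lower (trans (cong (at (state t)) e) (seg1 t u1 (<⇒≤ u2))))
      }
      where
      K3' : 2 ≤ K
      K3' = ≤-trans (n≤1+n 2) K3
      e2 : at (state (suc (g 1))) p ≡ f 2
      e2 = subst (λ z → at (state (suc z)) p ≡ f 2) (sym hg1)
             (trans (cong (at (state (suc t1))) (sym hp)) (trans (state-step-lower t1 t1N) (trans (cong (λ z → at (state t1) (suc z)) hp) hs2)))
      seg1 : ∀ t → g 1 < t → t ≤ g 2 → at (state t) p ≡ f 2
      seg1 = stays-between (g 1) (g 2) p (f 2) (<⇒≤ (proj₁ (hV 2 (s≤s k1)))) (<-trans (n<1+n p) pn) e2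
               (λ u u1 u2 → hS 1 (s≤s z≤n) u (inj₁ (u1 , u2)))

    next : ∀ i → State i → p ≡ suc (W (g (2 + i))) → State (suc i)
    next i S pS = record
      { bnd = bnd'
      ; inc = inc'
      ; seg = seg'
      ; low = low'
      ; first = <-trans (State.first S) τ<
      ; noP = noP'
      }
      where
      open State S
      τ = g (2 + i)
      x = f (2 + i)
      y = f (3 + i)
      iK : 2 + i ≤ suc K
      iK = ≤-trans bnd (n≤1+n K)
      hτ : τ < N
      hτ = proj₁ (hV (2 + i) iK)
      cτ : Cross τ x y
      cτ = proj₂ (hV (2 + i) iK)
      xp : at (state τ) p ≡ x
      xp = seg (suc i) (s≤s z≤n) ≤-refl τ (inc (suc i) (s≤s z≤n) ≤-refl) ≤-refl
      xS : at (state τ) (suc (W τ)) ≡ x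
      xS = subst (λ z → at (state τ) z ≡ x) pS xp
      yW : at (state τ) (W τ) ≡ y
      yW = cross-lower hτ cτ xS
      Byx : Below τ y x
      Byx = below (W τ) (suc (W τ)) (n<1+n (W τ)) (suc-W<n τ hτ) yW xS
      Bprev : Below (g i) x (f (1 + i))
      Bprev = bprev i refl
        where
        bprev : ∀ i' → i' ≡ i → Below (g i) x (f (1 + i))
        bprev zero refl = below-after-cross t1N (cross-sym c1) (n<1+n t1) t1<g0 t1N (<⇒≤ (proj₁ (hV 0 z≤n))) B1
          where
          c1 : Cross t1 (f 1) (f 2)
          c1 = subst (λ z → Cross z (f 1) (f 2)) hg1 (proj₂ (hV 1 (s≤s z≤n)))
          t1<g0 : t1 < g 0
          t1<g0 = subst (_< g 0) hg1 (≤∧≢⇒< (hMin 0 z≤n) (λ e → hD 0 z≤n (sym e)))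
          B1 : Below (suc t1) (f 2) (f 1)
          B1 = below p (suc p) (n<1+n p) pn
                 (trans (cong (at (state (suc t1))) (sym hp)) (trans (state-step-lower t1 t1N) (trans (cong (λ z → at (state t1) (suc z)) hp) hs2)))
                 (trans (cong (λ z → at (state (suc t1)) (suc z)) (sym hp)) (trans (state-step-upper t1 t1N) (trans (cong (at (state t1)) hp) hs1)))
        bprev (suc i') refl = below-before-cross hc1 (cross-sym cc1) ≤-refl (<⇒≤ (inc (suc i') (s≤s z≤n) (n≤1+n (suc i')))) B2
          where
          c = g (suc i)
          hc1 : c < N
          hc1 = proj₁ (hV (suc i) (≤-trans (n≤1+n (suc i)) iK))
          cc1 : Cross c (f (suc i)) x
          cc1 = proj₂ (hV (suc i) (≤-trans (n≤1+n (suc i)) iK))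
          lowc : suc (W c) ≡ p
          lowc = low (suc i) (s≤s (s≤s z≤n)) ≤-refl
          pc : at (state c) p ≡ f (suc i)
          pc = seg i (s≤s z≤n) (n≤1+n i) c (inc i (s≤s z≤n) (n≤1+n i)) ≤-refl
          B2 : Below c x (f (suc i))
          B2 = below (W c) (suc (W c)) (n<1+n (W c)) (suc-W<n c hc1)
                 (cross-lower hc1 cc1 (trans (cong (at (state c)) lowc) pc))
                 (trans (cong (at (state c)) lowc) pc)
      Bnext : Below (g (3 + i)) x y
      Bnext = hSide i (≤-trans (n≤1+n (suc i)) bnd) Bprev
      i3K : 3 + i ≤ suc K
      i3K = s≤s bnd
      τ< : τ < g (3 + i)
      τ< with <-cmp τ (g (3 + i))
      ... | tri< lt _ _ = lt
      ... | tri≈ _ e _ = ⊥-elim (hD (2 + i) iK e)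
      ... | tri> _ _ gt = ⊥-elim (below-asym Bnext (below-before-cross hτ (cross-sym cτ) ≤-refl (<⇒≤ gt) Byx))
      g3N : g (3 + i) < N
      g3N = proj₁ (hV (3 + i) i3K)
      yp1 : at (state (suc τ)) p ≡ y
      yp1 = trans (cong (at (state (suc τ))) pS) (trans (state-step-upper τ hτ) yW)
      nInvY : ∀ u → τ < u → u < g (3 + i) → Involves u y → ⊥
      nInvY u u1 u2 = hS (2 + i) iK u (inj₁ (u1 , u2))
      segY : ∀ t → τ < t → t ≤ g (3 + i) → at (state t) p ≡ y
      segY = stays-between τ (g (3 + i)) p y (<⇒≤ g3N) (<-trans (n<1+n p) pn) yp1 nInvY
      bnd' : 3 + i ≤ K
      bnd' = ≤-pred (≤∧≢⇒< i3K (λ e → <-irrefl (sym (trans (cong g e) hPer)) (<-trans (State.first S) τ<)))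
      inc' : ∀ m → 1 ≤ m → m ≤ suc (suc i) → g m < g (suc m)
      inc' m h1 h2 with ≤-suc-cases h2
      ... | inj₁ le = inc m h1 le
      ... | inj₂ refl = τ<
      seg' : ∀ m → 1 ≤ m → m ≤ suc (suc i) → ∀ t → g m < t → t ≤ g (suc m) → at (state t) p ≡ f (suc m)
      seg' m h1 h2 with ≤-suc-cases h2
      ... | inj₁ le = seg m h1 le
      ... | inj₂ refl = segY
      low' : ∀ m → 2 ≤ m → m ≤ suc (suc i) → suc (W (g m)) ≡ p
      low' m h1 h2 with ≤-suc-cases h2
      ... | inj₁ le = low m h1 le
      ... | inj₂ refl = sym pS
      noP' : ∀ t → g 1 < t → t < g (3 + i) → W t ≢ p
      noP' t u1 u2 with <-cmp t τ
      ... | tri< lt _ _ = noP t u1 lt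
      ... | tri≈ _ refl _ = λ e → <-irrefl (trans e pS) (n<1+n (W τ))
      ... | tri> _ _ gt = λ e → nInvY t gt u2 (at-lower (trans (cong (at (state t)) e) (segY t gt (<⇒≤ u2))))

    Out : Set
    Out = Σ ℕ λ a → State a × W (g (2 + a)) ≡ p

    walk : ∀ d i → d + i ≡ K → State i → Out
    walk zero i e S = ⊥-elim (<-irrefl refl (≤-trans (n≤1+n (suc i)) (subst (λ z → 2 + i ≤ z) (sym e) (State.bnd S))))
    walk (suc d) i e S with involves-position {x = f (2 + i)} hτ (<-trans (n<1+n p) pn) xp (cross-involves₁ cτ)
      where
      iK : 2 + i ≤ suc K
      iK = ≤-trans (State.bnd S) (n≤1+n K)
      hτ : g (2 + i) < N
      hτ = proj₁ (hV (2 + i) iK)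
      cτ : Cross (g (2 + i)) (f (2 + i)) (f (3 + i))
      cτ = proj₂ (hV (2 + i) iK)
      xp : at (state (g (2 + i))) p ≡ f (2 + i)
      xp = State.seg S (suc i) (s≤s z≤n) ≤-refl (g (2 + i)) (State.inc S (suc i) (s≤s z≤n) ≤-refl) ≤-refl
    ... | inj₁ pW = i , S , sym pW
    ... | inj₂ pS = walk d (suc i) (trans (+-suc d i) e) (next i S pS)

    result : Out
    result = walk K 0 (+-identityʳ K) base

  -- The mirror image of LowerWalk, at position p + 1.
  module UpperWalk (K : ℕ) (K3 : 3 ≤ K) (f g : ℕ → ℕ) (p t1 : ℕ)
    (hV : ∀ j → j ≤ suc K → g j < N × Cross (g j) (f j) (f (suc j)))
    (hS : ∀ j → j ≤ suc K → ∀ t → Between (g j) (g (suc j)) t → Involves t (f (suc j)) → ⊥)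
    (hD : ∀ j → j ≤ suc K → g j ≢ g (suc j))
    (hMin : ∀ j → j ≤ suc K → g 1 ≤ g j)
    (hPer : g (suc K) ≡ g 1)
    (hSide : ∀ i → i < K → Below (g i) (f (1 + i)) (f (2 + i)) → Below (g (3 + i)) (f (3 + i)) (f (2 + i)))
    (hg1 : g 1 ≡ t1) (hp : W t1 ≡ p)
    (hs1 : at (state t1) (suc p) ≡ f 1) (hs2 : at (state t1) p ≡ f 2)
    where

    record State (i : ℕ) : Set where
      field
        bnd : 2 + i ≤ K
        inc : ∀ m → 1 ≤ m → m ≤ suc i → g m < g (suc m)
        seg : ∀ m → 1 ≤ m → m ≤ suc i → ∀ t → g m < t → t ≤ g (suc m) → at (state t) (suc p) ≡ f (suc m)
        low : ∀ m → 2 ≤ m → m ≤ suc i → W (g m) ≡ suc p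
        first : g 1 < g (2 + i)
        noP : ∀ t → g 1 < t → t < g (2 + i) → W t ≢ p

    t1N : t1 < N
    t1N = subst (_< N) hg1 (proj₁ (hV 1 (s≤s z≤n)))

    pn : suc p < n
    pn = subst (λ z → suc z < n) hp (suc-W<n t1 t1N)

    k1 : 1 ≤ K
    k1 = ≤-trans (s≤s z≤n) K3

    g12 : g 1 < g 2
    g12 = ≤∧≢⇒< (hMin 2 (s≤s k1)) (hD 1 (s≤s z≤n))

    base : State 0
    base = record
      { bnd = K3'
      ; inc = λ { m h1 h2 → subst (λ z → g z < g (suc z)) (sym (≤-antisym h2 h1)) g12 }
      ; seg = λ { m h1 h2 t u1 u2 → subst (λ z → at (state t) (suc p) ≡ f (suc z)) (sym (≤-antisym h2 h1)) (seg1 t (subst (λ z → g z < t) (≤-antisym h2 h1) u1) (subst (λ z → t ≤ g (suc z)) (≤-antisym h2 h1) u2)) }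
      ; low = λ { m h1 h2 → ⊥-elim (<-irrefl refl (≤-trans h1 h2)) }
      ; first = g12
      ; noP = λ t u1 u2 e → hS 1 (s≤s z≤n) t (inj₁ (u1 , u2)) (at-upper (trans (cong (λ z → at (state t) (suc z)) e) (seg1 t u1 (<⇒≤ u2))))
      }
      where
      K3' : 2 ≤ K
      K3' = ≤-trans (n≤1+n 2) K3
      e2 : at (state (suc (g 1))) (suc p) ≡ f 2
      e2 = subst (λ z → at (state (suc z)) (suc p) ≡ f 2) (sym hg1)
             (trans (cong (λ z → at (state (suc t1)) (suc z)) (sym hp)) (trans (state-step-upper t1 t1N) (trans (cong (at (state t1)) hp) hs2)))
      seg1 : ∀ t → g 1 < t → t ≤ g 2 → at (state t) (suc p) ≡ f 2
      seg1 = stays-between (g 1) (g 2) (suc p) (f 2) (<⇒≤ (proj₁ (hV 2 (s≤s k1)))) pn e2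
               (λ u u1 u2 → hS 1 (s≤s z≤n) u (inj₁ (u1 , u2)))

    next : ∀ i → State i → suc p ≡ W (g (2 + i)) → State (suc i)
    next i S pS = record
      { bnd = bnd'
      ; inc = inc'
      ; seg = seg'
      ; low = low'
      ; first = <-trans (State.first S) τ<
      ; noP = noP'
      }
      where
      open State S
      τ = g (2 + i)
      x = f (2 + i)
      y = f (3 + i)
      iK : 2 + i ≤ suc K
      iK = ≤-trans bnd (n≤1+n K)
      hτ : τ < N
      hτ = proj₁ (hV (2 + i) iK)
      cτ : Cross τ x y
      cτ = proj₂ (hV (2 + i) iK)
      xp : at (state τ) (suc p) ≡ x
      xp = seg (suc i) (s≤s z≤n) ≤-refl τ (inc (suc i) (s≤s z≤n) ≤-refl) ≤-refl
      xW : at (state τ) (W τ) ≡ x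
      xW = subst (λ z → at (state τ) z ≡ x) pS xp
      yS : at (state τ) (suc (W τ)) ≡ y
      yS = cross-upper hτ cτ xW
      Bxy : Below τ x y
      Bxy = below (W τ) (suc (W τ)) (n<1+n (W τ)) (suc-W<n τ hτ) xW yS
      Bprev : Below (g i) (f (1 + i)) x
      Bprev = bprev i refl
        where
        bprev : ∀ i' → i' ≡ i → Below (g i) (f (1 + i)) x
        bprev zero refl = below-after-cross t1N c1 (n<1+n t1) t1<g0 t1N (<⇒≤ (proj₁ (hV 0 z≤n))) B1
          where
          c1 : Cross t1 (f 1) (f 2)
          c1 = subst (λ z → Cross z (f 1) (f 2)) hg1 (proj₂ (hV 1 (s≤s z≤n)))
          t1<g0 : t1 < g 0
          t1<g0 = subst (_< g 0) hg1 (≤∧≢⇒< (hMin 0 z≤n) (λ e → hD 0 z≤n (sym e)))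
          B1 : Below (suc t1) (f 1) (f 2)
          B1 = below p (suc p) (n<1+n p) pn
                 (trans (cong (at (state (suc t1))) (sym hp)) (trans (state-step-lower t1 t1N) (trans (cong (λ z → at (state t1) (suc z)) hp) hs1)))
                 (trans (cong (λ z → at (state (suc t1)) (suc z)) (sym hp)) (trans (state-step-upper t1 t1N) (trans (cong (at (state t1)) hp) hs2)))
        bprev (suc i') refl = below-before-cross hc1 cc1 ≤-refl (<⇒≤ (inc (suc i') (s≤s z≤n) (n≤1+n (suc i')))) B2
          where
          c = g (suc i)
          hc1 : c < N
          hc1 = proj₁ (hV (suc i) (≤-trans (n≤1+n (suc i)) iK))
          cc1 : Cross c (f (suc i)) x
          cc1 = proj₂ (hV (suc i) (≤-trans (n≤1+n (suc i)) iK))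
          upc : W c ≡ suc p
          upc = low (suc i) (s≤s (s≤s z≤n)) ≤-refl
          pc : at (state c) (suc p) ≡ f (suc i)
          pc = seg i (s≤s z≤n) (n≤1+n i) c (inc i (s≤s z≤n) (n≤1+n i)) ≤-refl
          B2 : Below c (f (suc i)) x
          B2 = below (W c) (suc (W c)) (n<1+n (W c)) (suc-W<n c hc1)
                 (trans (cong (at (state c)) upc) pc)
                 (cross-upper hc1 cc1 (trans (cong (at (state c)) upc) pc))
      Bnext : Below (g (3 + i)) y x
      Bnext = hSide i (≤-trans (n≤1+n (suc i)) bnd) Bprev
      i3K : 3 + i ≤ suc K
      i3K = s≤s bnd
      τ< : τ < g (3 + i)
      τ< with <-cmp τ (g (3 + i))
      ... | tri< lt _ _ = lt
      ... | tri≈ _ e _ = ⊥-elim (hD (2 + i) iK e)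
      ... | tri> _ _ gt = ⊥-elim (below-asym Bnext (below-before-cross hτ cτ ≤-refl (<⇒≤ gt) Bxy))
      g3N : g (3 + i) < N
      g3N = proj₁ (hV (3 + i) i3K)
      yp1 : at (state (suc τ)) (suc p) ≡ y
      yp1 = trans (cong (at (state (suc τ))) pS) (trans (state-step-lower τ hτ) yS)
      nInvY : ∀ u → τ < u → u < g (3 + i) → Involves u y → ⊥
      nInvY u u1 u2 = hS (2 + i) iK u (inj₁ (u1 , u2))
      segY : ∀ t → τ < t → t ≤ g (3 + i) → at (state t) (suc p) ≡ y
      segY = stays-between τ (g (3 + i)) (suc p) y (<⇒≤ g3N) pn yp1 nInvY
      bnd' : 3 + i ≤ K
      bnd' = ≤-pred (≤∧≢⇒< i3K (λ e → <-irrefl (sym (trans (cong g e) hPer)) (<-trans (State.first S) τ<)))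
      inc' : ∀ m → 1 ≤ m → m ≤ suc (suc i) → g m < g (suc m)
      inc' m h1 h2 with ≤-suc-cases h2
      ... | inj₁ le = inc m h1 le
      ... | inj₂ refl = τ<
      seg' : ∀ m → 1 ≤ m → m ≤ suc (suc i) → ∀ t → g m < t → t ≤ g (suc m) → at (state t) (suc p) ≡ f (suc m)
      seg' m h1 h2 with ≤-suc-cases h2
      ... | inj₁ le = seg m h1 le
      ... | inj₂ refl = segY
      low' : ∀ m → 2 ≤ m → m ≤ suc (suc i) → W (g m) ≡ suc p
      low' m h1 h2 with ≤-suc-cases h2
      ... | inj₁ le = low m h1 le
      ... | inj₂ refl = sym pS
      noP' : ∀ t → g 1 < t → t < g (3 + i) → W t ≢ p
      noP' t u1 u2 with <-cmp t τ
      ... | tri< lt _ _ = noP t u1 lt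
      ... | tri≈ _ refl _ = λ e → <-irrefl (sym (trans pS e)) (n<1+n p)
      ... | tri> _ _ gt = λ e → nInvY t gt u2 (at-upper (trans (cong (λ z → at (state t) (suc z)) e) (segY t gt (<⇒≤ u2))))

    Out : Set
    Out = Σ ℕ λ a → State a × W (g (2 + a)) ≡ p

    walk : ∀ d i → d + i ≡ K → State i → Out
    walk zero i e S = ⊥-elim (<-irrefl refl (≤-trans (n≤1+n (suc i)) (subst (λ z → 2 + i ≤ z) (sym e) (State.bnd S))))
    walk (suc d) i e S with involves-position {x = f (2 + i)} hτ pn xp (cross-involves₁ cτ)
      where
      iK : 2 + i ≤ suc K
      iK = ≤-trans (State.bnd S) (n≤1+n K)
      hτ : g (2 + i) < N
      hτ = proj₁ (hV (2 + i) iK)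
      cτ : Cross (g (2 + i)) (f (2 + i)) (f (3 + i))
      cτ = proj₂ (hV (2 + i) iK)
      xp : at (state (g (2 + i))) (suc p) ≡ f (2 + i)
      xp = State.seg S (suc i) (s≤s z≤n) ≤-refl (g (2 + i)) (State.inc S (suc i) (s≤s z≤n) ≤-refl) ≤-refl
    ... | inj₂ pW = i , S , suc-injective (sym pW)
    ... | inj₁ pS = walk d (suc i) (trans (+-suc d i) e) (next i S pS)

    result : Out
    result = walk K 0 (+-identityʳ K) base

module Cycle (n : ℕ) (w : List ℕ) (hw : All (λ p → suc p < n) w)
           (hc : ∀ i j → i < n → j < n → i ≢ j → count (isPair i j) (crossings n w) ≡ 1)
           (is : List ℕ) (K'' : ℕ)
           (hDist : ∀ u v → at is (u % (3 + K'')) ≡ at is (v % (3 + K'')) → u % (3 + K'') ≡ v % (3 + K''))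
           (hRange : ∀ j → at is (j % (3 + K'')) < n)
           (hAdj : ∀ m → AdjacentIn (O n w (at is ((1 + m) % (3 + K'')))) (at is (m % (3 + K''))) (at is ((2 + m) % (3 + K''))))
           where
  open Arrangement n w hw hc
  open Rows n w hw hc

  K : ℕ
  K = 3 + K''
  K' : ℕ
  K' = 2 + K''

  I : ℕ → ℕ
  I j = at is (j % K)

  I-periodic : ∀ u q → I (u + q * K) ≡ I u
  I-periodic u q = cong (at is) ([m+kn]%n≡m%n u q K)

  I-≡ : ∀ u v q → u ≡ v + q * K → I u ≡ I v
  I-≡ u v q e = trans (cong I e) (I-periodic v q)

  I-≢ : ∀ c e → 0 < e → e < K → I c ≢ I (c + e)
  I-≢ c e h1 h2 eq = <-irrefl (sym ([m+e]%n≡m%n⇒e≡0 c e K (sym (hDist c (c + e) eq)) h2)) h1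

  I-≢-suc : ∀ m → I m ≢ I (1 + m)
  I-≢-suc m eq = I-≢ m 1 (s≤s z≤n) (s≤s (s≤s z≤n)) (trans eq (cong I (+-comm 1 m)))

  θ-exists : ∀ m → Σ ℕ λ t → t < N × Cross t (I m) (I (1 + m))
  θ-exists m = cross-exists (I m) (I (1 + m)) (hRange m) (hRange (1 + m)) (I-≢-suc m)

  abstract
    θ : ℕ → ℕ
    θ m = proj₁ (θ-exists m)

    θ<N : ∀ m → θ m < N
    θ<N m = proj₁ (proj₂ (θ-exists m))

    θ-cross : ∀ m → Cross (θ m) (I m) (I (1 + m))
    θ-cross m = proj₂ (proj₂ (θ-exists m))

  θ-unique : ∀ {t} m → t < N → Cross t (I m) (I (1 + m)) → t ≡ θ m
  θ-unique m h c = cross-unique h (θ<N m) c (θ-cross m)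

  θ-periodic : ∀ u q → θ (u + q * K) ≡ θ u
  θ-periodic u q = θ-unique u (θ<N (u + q * K)) (subst₂ (Cross (θ (u + q * K))) (I-periodic u q) (I-periodic (suc u) q) (θ-cross (u + q * K)))

  θ-≡ : ∀ u v q → u ≡ v + q * K → θ u ≡ θ v
  θ-≡ u v q e = trans (cong θ e) (θ-periodic v q)

  sides-consecutive : ∀ m → (θ m ≢ θ (1 + m)) × (∀ t → Between (θ m) (θ (1 + m)) t → Involves t (I (1 + m)) → ⊥)
  sides-consecutive m with adjacentIn⇒consecutive (I (1 + m)) (I m) (I (2 + m)) (hAdj m)
  ... | θ1 , θ2 , lt , hN , inj₁ (c1 , c2) , gp = (λ e → <-irrefl (trans e1 (trans e (sym e2))) lt) , bt
    where
    e1 : θ1 ≡ θ m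
    e1 = θ-unique m (<-trans lt hN) (cross-sym c1)
    e2 : θ2 ≡ θ (1 + m)
    e2 = θ-unique (1 + m) hN c2
    bt : ∀ t → Between (θ m) (θ (1 + m)) t → Involves t (I (1 + m)) → ⊥
    bt t (inj₁ (u1 , u2)) = gp t (subst (_< t) (sym e1) u1) (subst (t <_) (sym e2) u2)
    bt t (inj₂ (u1 , u2)) = ⊥-elim (<-irrefl refl (<-trans (<-trans u1 u2) (subst₂ _<_ e1 e2 lt)))
  ... | θ1 , θ2 , lt , hN , inj₂ (c1 , c2) , gp = (λ e → <-irrefl (trans e1 (trans (sym e) (sym e2))) lt) , bt
    where
    e1 : θ1 ≡ θ (1 + m)
    e1 = θ-unique (1 + m) (<-trans lt hN) c1
    e2 : θ2 ≡ θ m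
    e2 = θ-unique m hN (cross-sym c2)
    bt : ∀ t → Between (θ m) (θ (1 + m)) t → Involves t (I (1 + m)) → ⊥
    bt t (inj₂ (u1 , u2)) = gp t (subst (_< t) (sym e1) u1) (subst (t <_) (sym e2) u2)
    bt t (inj₁ (u1 , u2)) = ⊥-elim (<-irrefl refl (<-trans (<-trans u1 u2) (subst₂ _<_ e1 e2 lt)))

  θ-≢-suc : ∀ m → θ m ≢ θ (1 + m)
  θ-≢-suc m = proj₁ (sides-consecutive m)

  side-free : ∀ m → ∀ t → Between (θ m) (θ (1 + m)) t → Involves t (I (1 + m)) → ⊥
  side-free m = proj₂ (sides-consecutive m)

  argmin-θ : Σ ℕ λ s → s < suc (2 + K'') × (∀ m → m < suc (2 + K'') → θ s ≤ θ m)
  argmin-θ = argmin θ (2 + K'')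

  abstract
    sMin : ℕ
    sMin = proj₁ argmin-θ

    sMin<K : sMin < K
    sMin<K = proj₁ (proj₂ argmin-θ)

    θ-min : ∀ m → θ sMin ≤ θ m
    θ-min m = subst (θ sMin ≤_) (sym (θ-≡ m (m % K) (m / K) (m≡m%n+[m/n]*n m K))) (proj₂ (proj₂ argmin-θ) (m % K) (m%n<n m K))

  +-exchange : ∀ a b c → a + (c + b) ≡ c + (a + b)
  +-exchange a b c = trans (sym (+-assoc a c b)) (trans (cong (_+ b) (+-comm a c)) (+-assoc c a b))

  -- The line x = I c lies on the same side of I u at time θ u for all the other sides u:
  -- I u and I (1 + u) are adjacent at θ u, and x does not cross I (1 + u) between θ u
  -- and θ (1 + u).
  module Side (c : ℕ) where
    x : ℕ
    x = I c

    Q : ℕ → Set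
    Q u = Below (θ u) x (I u)

    xne : ∀ e → 0 < e → e < K → x ≢ I (c + e)
    xne e h1 h2 = I-≢ c e h1 h2

    cross-outside : ∀ u → x ≢ I u → x ≢ I (2 + u) → ∀ v → v < N → Cross v x (I (1 + u)) →
      (v < θ u × v < θ (1 + u)) ⊎ (θ u ≤ v × θ (1 + u) ≤ v)
    cross-outside u n0 n2 v hv cv with <-cmp v (θ u) | <-cmp v (θ (1 + u))
    ... | tri≈ _ e _ | _ = ⊥-elim (n0 (cross-functional (θ<N u) (cross-sym (subst (λ z → Cross z x (I (1 + u))) e cv)) (cross-sym (θ-cross u))))
    ... | tri< _ _ _ | tri≈ _ e _ = ⊥-elim (n2 (cross-functional (θ<N (1 + u)) (cross-sym (subst (λ z → Cross z x (I (1 + u))) e cv)) (θ-cross (1 + u))))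
    ... | tri> _ _ _ | tri≈ _ e _ = ⊥-elim (n2 (cross-functional (θ<N (1 + u)) (cross-sym (subst (λ z → Cross z x (I (1 + u))) e cv)) (θ-cross (1 + u))))
    ... | tri< a _ _ | tri< b _ _ = inj₁ (a , b)
    ... | tri> _ _ a | tri> _ _ b = inj₂ (<⇒≤ a , <⇒≤ b)
    ... | tri< a _ _ | tri> _ _ b = ⊥-elim (side-free u v (inj₂ (b , a)) (cross-involves₂ cv))
    ... | tri> _ _ a | tri< b _ _ = ⊥-elim (side-free u v (inj₁ (a , b)) (cross-involves₂ cv))

    ⊎-swap-× : ∀ {A B C D : Set} → (A × B) ⊎ (C × D) → (B × A) ⊎ (D × C)
    ⊎-swap-× (inj₁ (a , b)) = inj₁ (b , a)
    ⊎-swap-× (inj₂ (a , b)) = inj₂ (b , a)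

    side-step : ∀ u → x ≢ I u → x ≢ I (1 + u) → x ≢ I (2 + u) → (Q u → Q (1 + u)) × (Q (1 + u) → Q u)
    side-step u n0 n1 n2 =
      (λ q → below-move (θ u) (θ (1 + u)) (<⇒≤ (θ<N u)) (<⇒≤ (θ<N (1 + u))) (cross-outside u n0 n2)
               (below-adjacent (cross⇒adjacent (θ<N u) (θ-cross u)) n0 n1 q)) ,
      (λ q → below-adjacent (adjacent-sym (cross⇒adjacent (θ<N u) (θ-cross u))) n1 n0
               (below-move (θ (1 + u)) (θ u) (<⇒≤ (θ<N (1 + u))) (<⇒≤ (θ<N u)) (λ v hv cv → ⊎-swap-× (cross-outside u n0 n2 v hv cv)) q))

    side-chain : ∀ d → d ≤ K'' → (Q (c + 1) → Q (c + (1 + d))) × (Q (c + (1 + d)) → Q (c + 1))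
    side-chain zero _ = (λ q → q) , (λ q → q)
    side-chain (suc d) h =
      (λ q → subst Q e1 (proj₁ stp (proj₁ ih q))) ,
      (λ q → proj₂ ih (proj₂ stp (subst Q (sym e1) q)))
      where
      ih = side-chain d (≤-trans (n≤1+n d) h)
      u = c + (1 + d)
      e1 : 1 + u ≡ c + (1 + suc d)
      e1 = +-exchange 1 (1 + d) c
      e2 : 2 + u ≡ c + (2 + suc d)
      e2 = +-exchange 2 (1 + d) c
      dK : 3 + d < K
      dK = s≤s (s≤s (s≤s h))
      k2 : 2 + d < K
      k2 = <-trans (n<1+n (2 + d)) dK
      k1 : 1 + d < K
      k1 = <-trans (n<1+n (1 + d)) k2
      stp = side-step u (xne (1 + d) (s≤s z≤n) k1)
                   (λ eq → xne (2 + d) (s≤s z≤n) k2 (trans eq (cong I e1)))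
                   (λ eq → xne (3 + d) (s≤s z≤n) dK (trans eq (cong I e2)))

    v : ℕ
    v = c + (1 + K'')

    eT : θ (c + K' + K') ≡ θ v
    eT = θ-≡ _ _ 1 (solve 2 (λ c k → c :+ (con 2 :+ k) :+ (con 2 :+ k) := c :+ (con 1 :+ k) :+ con 1 :* (con 3 :+ k)) refl c K'')

    eI : I (c + K') ≡ I (1 + v)
    eI = cong I (sym (+-exchange 1 (1 + K'') c))

    vx0 : x ≢ I v
    vx0 = xne (1 + K'') (s≤s z≤n) (s≤s (s≤s (n≤1+n K'')))
    vx1 : x ≢ I (1 + v)
    vx1 eq = xne (2 + K'') (s≤s z≤n) ≤-refl (trans eq (cong I (+-exchange 1 (1 + K'') c)))

    side : (Below (θ (c + K' + K')) x (I (c + K')) → Below (θ (1 + c)) x (I (1 + c))) ×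
           (Below (θ (1 + c)) x (I (1 + c)) → Below (θ (c + K' + K')) x (I (c + K')))
    side = (λ b → subst Q (+-comm c 1) (proj₂ (side-chain K'' ≤-refl)
                    (below-adjacent (adjacent-sym (cross⇒adjacent (θ<N v) (θ-cross v))) vx1 vx0 (subst₂ (λ z1 z2 → Below z1 x z2) eT eI b)))) ,
           (λ b → subst₂ (λ z1 z2 → Below z1 x z2) (sym eT) (sym eI)
                    (below-adjacent (cross⇒adjacent (θ<N v) (θ-cross v)) vx0 vx1 (proj₁ (side-chain K'' ≤-refl) (subst Q (+-comm 1 c) b))))

module FaceFromCycle (n : ℕ) (w : List ℕ) (hw : All (λ p → suc p < n) w)
           (hc : ∀ i j → i < n → j < n → i ≢ j → count (isPair i j) (crossings n w) ≡ 1)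
           (is : List ℕ) (K'' : ℕ)
           (hDist : ∀ u v → at is (u % (3 + K'')) ≡ at is (v % (3 + K'')) → u % (3 + K'') ≡ v % (3 + K''))
           (hRange : ∀ j → at is (j % (3 + K'')) < n)
           (hAdj : ∀ m → AdjacentIn (O n w (at is ((1 + m) % (3 + K'')))) (at is (m % (3 + K''))) (at is ((2 + m) % (3 + K''))))
           (hLen : length is ≡ 3 + K'')
           where
  open Arrangement n w hw hc
  open Rows n w hw hc
  open Cycle n w hw hc is K'' hDist hRange hAdj
  open Walks n w hw hc

  s : ℕ
  s = sMin
  t1 : ℕ
  t1 = θ s
  p : ℕ
  p = W t1

  -- The cycle traversed forwards (fF) and backwards (fB) from the earliest vertex θ s,
  -- indexed so that both walks start there at index 1; note K' ≡ -1 (mod K).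
  c0 : ℕ
  c0 = s + K'
  fF : ℕ → ℕ
  fF j = I (c0 + j)
  gF : ℕ → ℕ
  gF j = θ (c0 + j)

  c1 : ℕ
  c1 = s + 2
  fB : ℕ → ℕ
  fB j = I (c1 + K' * j)
  gB : ℕ → ℕ
  gB j = θ (c1 + K' * suc j)

  hVF : ∀ j → j ≤ suc K → gF j < N × Cross (gF j) (fF j) (fF (suc j))
  hVF j _ = θ<N (c0 + j) , subst (Cross (gF j) (fF j)) (cong I (sym (+-suc c0 j))) (θ-cross (c0 + j))

  hSF : ∀ j → j ≤ suc K → ∀ t → Between (gF j) (gF (suc j)) t → Involves t (fF (suc j)) → ⊥
  hSF j _ t b i = side-free (c0 + j) t (subst (λ z → Between (gF j) z t) (cong θ (+-suc c0 j)) b) (subst (Involves t) (cong I (+-suc c0 j)) i)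

  hDF : ∀ j → j ≤ suc K → gF j ≢ gF (suc j)
  hDF j _ e = θ-≢-suc (c0 + j) (trans e (cong θ (+-suc c0 j)))

  gF1 : gF 1 ≡ t1
  gF1 = θ-≡ (c0 + 1) s 1 (solve 2 (λ s k → s :+ (con 2 :+ k) :+ con 1 := s :+ con 1 :* (con 3 :+ k)) refl s K'')

  hMinF : ∀ j → j ≤ suc K → gF 1 ≤ gF j
  hMinF j _ = subst (_≤ gF j) (sym gF1) (θ-min (c0 + j))

  hPerF : gF (suc K) ≡ gF 1
  hPerF = θ-≡ (c0 + suc K) (c0 + 1) 1 (solve 2 (λ s k → s :+ (con 2 :+ k) :+ (con 4 :+ k) := s :+ (con 2 :+ k) :+ con 1 :+ con 1 :* (con 3 :+ k)) refl s K'')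

  module SF (i : ℕ) where
    c = c0 + (2 + i)
    eg0 : θ (c + K' + K') ≡ gF i
    eg0 = θ-≡ _ _ 2 (solve 3 (λ s k i → s :+ (con 2 :+ k) :+ (con 2 :+ i) :+ (con 2 :+ k) :+ (con 2 :+ k) := s :+ (con 2 :+ k) :+ i :+ con 2 :* (con 3 :+ k)) refl s K'' i)
    ef1 : I (c + K') ≡ fF (1 + i)
    ef1 = I-≡ _ _ 1 (solve 3 (λ s k i → s :+ (con 2 :+ k) :+ (con 2 :+ i) :+ (con 2 :+ k) := s :+ (con 2 :+ k) :+ (con 1 :+ i) :+ con 1 :* (con 3 :+ k)) refl s K'' i)
    eg3 : θ (1 + c) ≡ gF (3 + i)
    eg3 = cong θ (+-exchange 1 (2 + i) c0)
    ef3 : I (1 + c) ≡ fF (3 + i)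
    ef3 = cong I (+-exchange 1 (2 + i) c0)
    open Side c public

  hSideFL : ∀ i → i < K → Below (gF i) (fF (2 + i)) (fF (1 + i)) → Below (gF (3 + i)) (fF (2 + i)) (fF (3 + i))
  hSideFL i _ B = subst₂ (λ z1 z2 → Below z1 (fF (2 + i)) z2) eg3 ef3 (proj₁ side (subst₂ (λ z1 z2 → Below z1 (fF (2 + i)) z2) (sym eg0) (sym ef1) B))
    where open SF i

  hSideFU : ∀ i → i < K → Below (gF i) (fF (1 + i)) (fF (2 + i)) → Below (gF (3 + i)) (fF (3 + i)) (fF (2 + i))
  hSideFU i _ B = ¬below⇒below _ _ _ (λ e → I-≢-suc c (trans e (sym ef3))) (hRange c) (hRange (c0 + (3 + i)))
      (λ B' → below-asym B (subst₂ (λ z1 z2 → Below z1 (fF (2 + i)) z2) eg0 ef1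
                 (proj₂ side (subst₂ (λ z1 z2 → Below z1 (fF (2 + i)) z2) (sym eg3) (sym ef3) B'))))
    where open SF i

  eqB1 : ∀ j → 1 + (c1 + K' * suc j) ≡ (c1 + K' * j) + 1 * K
  eqB1 j = solve 3 (λ s k j → con 1 :+ (s :+ con 2 :+ (con 2 :+ k) :* (con 1 :+ j)) := (s :+ con 2 :+ (con 2 :+ k) :* j) :+ con 1 :* (con 3 :+ k)) refl s K'' j

  hVB : ∀ j → j ≤ suc K → gB j < N × Cross (gB j) (fB j) (fB (suc j))
  hVB j _ = θ<N (c1 + K' * suc j) , cross-sym (subst (Cross (gB j) (fB (suc j))) (I-≡ _ _ 1 (eqB1 j)) (θ-cross (c1 + K' * suc j)))

  hSB : ∀ j → j ≤ suc K → ∀ t → Between (gB j) (gB (suc j)) t → Involves t (fB (suc j)) → ⊥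
  hSB j _ t b i = side-free (c1 + K' * suc (suc j)) t (subst (λ z → Between (gB (suc j)) z t) (sym (θ-≡ _ _ 1 (eqB1 (suc j)))) (Between-sym b))
                   (subst (Involves t) (sym (I-≡ _ _ 1 (eqB1 (suc j)))) i)

  hDB : ∀ j → j ≤ suc K → gB j ≢ gB (suc j)
  hDB j _ e = θ-≢-suc (c1 + K' * suc (suc j)) (trans (sym e) (sym (θ-≡ _ _ 1 (eqB1 (suc j)))))

  gB1 : gB 1 ≡ t1
  gB1 = θ-≡ _ s 2 (solve 2 (λ s k → s :+ con 2 :+ (con 2 :+ k) :* con 2 := s :+ con 2 :* (con 3 :+ k)) refl s K'')

  hMinB : ∀ j → j ≤ suc K → gB 1 ≤ gB j
  hMinB j _ = subst (_≤ gB j) (sym gB1) (θ-min (c1 + K' * suc j))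

  hPerB : gB (suc K) ≡ gB 1
  hPerB = θ-≡ _ _ K' (solve 2 (λ s k → s :+ con 2 :+ (con 2 :+ k) :* (con 5 :+ k) := s :+ con 2 :+ (con 2 :+ k) :* con 2 :+ (con 2 :+ k) :* (con 3 :+ k)) refl s K'')

  module SB (i : ℕ) where
    c = c1 + K' * (2 + i)
    eg0 : θ (1 + c) ≡ gB i
    eg0 = θ-≡ _ _ 1 (solve 3 (λ s k i → con 1 :+ (s :+ con 2 :+ (con 2 :+ k) :* (con 2 :+ i)) := s :+ con 2 :+ (con 2 :+ k) :* (con 1 :+ i) :+ con 1 :* (con 3 :+ k)) refl s K'' i)
    ef1 : I (1 + c) ≡ fB (1 + i)
    ef1 = I-≡ _ _ 1 (solve 3 (λ s k i → con 1 :+ (s :+ con 2 :+ (con 2 :+ k) :* (con 2 :+ i)) := s :+ con 2 :+ (con 2 :+ k) :* (con 1 :+ i) :+ con 1 :* (con 3 :+ k)) refl s K'' i)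
    eg3 : θ (c + K' + K') ≡ gB (3 + i)
    eg3 = cong θ (solve 3 (λ s k i → s :+ con 2 :+ (con 2 :+ k) :* (con 2 :+ i) :+ (con 2 :+ k) :+ (con 2 :+ k) := s :+ con 2 :+ (con 2 :+ k) :* (con 4 :+ i)) refl s K'' i)
    ef3 : I (c + K') ≡ fB (3 + i)
    ef3 = cong I (solve 3 (λ s k i → s :+ con 2 :+ (con 2 :+ k) :* (con 2 :+ i) :+ (con 2 :+ k) := s :+ con 2 :+ (con 2 :+ k) :* (con 3 :+ i)) refl s K'' i)
    open Side c public

  hSideBL : ∀ i → i < K → Below (gB i) (fB (2 + i)) (fB (1 + i)) → Below (gB (3 + i)) (fB (2 + i)) (fB (3 + i))
  hSideBL i _ B = subst₂ (λ z1 z2 → Below z1 (fB (2 + i)) z2) eg3 ef3 (proj₂ side (subst₂ (λ z1 z2 → Below z1 (fB (2 + i)) z2) (sym eg0) (sym ef1) B))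
    where open SB i

  hSideBU : ∀ i → i < K → Below (gB i) (fB (1 + i)) (fB (2 + i)) → Below (gB (3 + i)) (fB (3 + i)) (fB (2 + i))
  hSideBU i _ B = ¬below⇒below _ _ _ (λ e → I-≢ c K' (s≤s z≤n) ≤-refl (trans e (sym ef3))) (hRange c) (hRange (c1 + K' * (3 + i)))
      (λ B' → below-asym B (subst₂ (λ z1 z2 → Below z1 (fB (2 + i)) z2) eg0 ef1
                 (proj₁ side (subst₂ (λ z1 z2 → Below z1 (fB (2 + i)) z2) (sym eg3) (sym ef3) B'))))
    where open SB i

  pn : suc p < n
  pn = suc-W<n t1 (θ<N s)

  module Meet (fL gL fU gU : ℕ → ℕ) (a b : ℕ)
    (hVL : gL (2 + a) < N × Cross (gL (2 + a)) (fL (2 + a)) (fL (3 + a)))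
    (hSL : ∀ j → j ≤ suc K → ∀ t → Between (gL j) (gL (suc j)) t → Involves t (fL (suc j)) → ⊥)
    (hSU : ∀ j → j ≤ suc K → ∀ t → Between (gU j) (gU (suc j)) t → Involves t (fU (suc j)) → ⊥)
    (gL1 : gL 1 ≡ t1) (gU1 : gU 1 ≡ t1)
    (bndL : 2 + a ≤ K)
    (incL : ∀ m → 1 ≤ m → m ≤ suc a → gL m < gL (suc m))
    (segL : ∀ m → 1 ≤ m → m ≤ suc a → ∀ t → gL m < t → t ≤ gL (suc m) → at (state t) p ≡ fL (suc m))
    (lowL : ∀ m → 2 ≤ m → m ≤ suc a → suc (W (gL m)) ≡ p)
    (firstL : gL 1 < gL (2 + a))
    (noPL : ∀ t → gL 1 < t → t < gL (2 + a) → W t ≢ p)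
    (finL : W (gL (2 + a)) ≡ p)
    (bndU : 2 + b ≤ K)
    (incU : ∀ m → 1 ≤ m → m ≤ suc b → gU m < gU (suc m))
    (segU : ∀ m → 1 ≤ m → m ≤ suc b → ∀ t → gU m < t → t ≤ gU (suc m) → at (state t) (suc p) ≡ fU (suc m))
    (upU : ∀ m → 2 ≤ m → m ≤ suc b → W (gU m) ≡ suc p)
    (firstU : gU 1 < gU (2 + b))
    (noPU : ∀ t → gU 1 < t → t < gU (2 + b) → W t ≢ p)
    (finU : W (gU (2 + b)) ≡ p)
    where

    t2 : ℕ
    t2 = gL (2 + a)

    t2N : t2 < N
    t2N = proj₁ hVL

    eqT2 : gU (2 + b) ≡ t2
    eqT2 = first-hit-unique W p t1 t2 (gU (2 + b)) (subst (_< t2) gL1 firstL) (subst (_< gU (2 + b)) gU1 firstU) finL finU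
             (λ t h1 h2 → noPL t (subst (_< t) (sym gL1) h1) h2) (λ t h1 h2 → noPU t (subst (_< t) (sym gU1) h1) h2)

    t1<t2 : t1 < t2
    t1<t2 = subst (_< t2) gL1 firstL

    face : IsBoundedFace n w t1 t2
    face = t1<t2 , t2N , sym finL , (λ t h1 h2 → noPL t (subst (_< t) (sym gL1) h1) h2)

    meet : fL (3 + a) ≡ fU (2 + b)
    meet = trans (sym eL) eU
      where
      xp : at (state t2) (W t2) ≡ fL (2 + a)
      xp = trans (cong (at (state t2)) finL) (segL (suc a) (s≤s z≤n) ≤-refl t2 (incL (suc a) (s≤s z≤n) ≤-refl) ≤-refl)
      eL : at (state t2) (suc p) ≡ fL (3 + a)
      eL = subst (λ z → at (state t2) (suc z) ≡ fL (3 + a)) finL (cross-upper t2N (proj₂ hVL) xp)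
      eU : at (state t2) (suc p) ≡ fU (2 + b)
      eU = subst (λ z → at (state z) (suc p) ≡ fU (2 + b)) eqT2 (segU (suc b) (s≤s z≤n) ≤-refl (gU (2 + b)) (incU (suc b) (s≤s z≤n) ≤-refl) ≤-refl)

    bL : ℕ → Bool
    bL t = suc (W t) ≡ᵇ W t1

    filtL : filter (λ t → T? (bL t)) (between t1 t2) ≡ map gL (range 2 a)
    filtL = trans (cong (filter (λ t → T? (bL t))) (between-range t1 t2))
      (Enumeration.enumerates-unique bL (suc t1) t2 _ _
        (subst (λ z → Enumeration.Enumerates bL (suc t1) z (filter (λ t → T? (bL t)) (range (suc t1) (t2 ∸ suc t1)))) (m+[n∸m]≡n t1<t2)
           (Enumeration.filter-enumerates bL (suc t1) (t2 ∸ suc t1)))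
        (subst (λ z → Enumeration.Enumerates bL (suc z) t2 (map gL (range 2 a))) gL1
           (Enumeration.map-enumerates bL gL a 1 (λ i h1 h2 → incL i h1 h2)
              (λ i h1 h2 t u1 u2 e → hSL i (≤-trans h2 (≤-trans (n≤1+n (suc a)) (≤-trans bndL (n≤1+n K)))) t (inj₁ (u1 , u2))
                  (at-upper (trans (cong (at (state t)) (≡ᵇ≡true⇒≡ _ _ e)) (segL i h1 h2 t u1 (<⇒≤ u2)))))
              (λ i h1 h2 → ≡⇒≡ᵇ≡true _ _ (lowL i h1 h2)))))

    lowerEq : lowerChain n w t1 t2 ≡ map fL (range 2 (suc a))
    lowerEq = cong₂ _∷_ hd (trans (cong (map (λ t → at (state (suc t)) p)) filtL)
                (trans (sym (map-∘ (range 2 a)))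
                  (trans (map-range-cong _ (λ j → fL (suc j)) 2 a
                            (λ i h1 h2 → segL i (≤-trans (n≤1+n 1) h1) (≤-pred h2) (suc (gL i)) ≤-refl
                                            (incL i (≤-trans (n≤1+n 1) h1) (≤-pred h2))))
                    (map-suc-range fL 2 a))))
      where
      hd : at (state (suc t1)) p ≡ fL 2
      hd = segL 1 ≤-refl (s≤s z≤n) (suc t1) (subst (_< suc t1) (sym gL1) ≤-refl)
             (subst (λ z → suc z ≤ gL 2) gL1 (incL 1 ≤-refl (s≤s z≤n)))

    bU : ℕ → Bool
    bU t = W t ≡ᵇ suc (W t1)

    filtU : filter (λ t → T? (bU t)) (between t1 t2) ≡ map gU (range 2 b)
    filtU = trans (cong (filter (λ t → T? (bU t))) (between-range t1 t2))
      (Enumeration.enumerates-unique bU (suc t1) t2 _ _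
        (subst (λ z → Enumeration.Enumerates bU (suc t1) z (filter (λ t → T? (bU t)) (range (suc t1) (t2 ∸ suc t1)))) (m+[n∸m]≡n t1<t2)
           (Enumeration.filter-enumerates bU (suc t1) (t2 ∸ suc t1)))
        (subst₂ (λ z1 z2 → Enumeration.Enumerates bU (suc z1) z2 (map gU (range 2 b))) gU1 eqT2
           (Enumeration.map-enumerates bU gU b 1 (λ i h1 h2 → incU i h1 h2)
              (λ i h1 h2 t u1 u2 e → hSU i (≤-trans h2 (≤-trans (n≤1+n (suc b)) (≤-trans bndU (n≤1+n K)))) t (inj₁ (u1 , u2))
                  (at-lower (trans (cong (at (state t)) (≡ᵇ≡true⇒≡ _ _ e)) (segU i h1 h2 t u1 (<⇒≤ u2)))))
              (λ i h1 h2 → ≡⇒≡ᵇ≡true _ _ (upU i h1 h2)))))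

    upperEq : upperChain n w t1 t2 ≡ map fU (range 2 (suc b))
    upperEq = cong₂ _∷_ hd (trans (cong (map (λ t → at (state (suc t)) (suc p))) filtU)
                (trans (sym (map-∘ (range 2 b)))
                  (trans (map-range-cong _ (λ j → fU (suc j)) 2 b
                            (λ i h1 h2 → segU i (≤-trans (n≤1+n 1) h1) (≤-pred h2) (suc (gU i)) ≤-refl
                                            (incU i (≤-trans (n≤1+n 1) h1) (≤-pred h2))))
                    (map-suc-range fU 2 b))))
      where
      hd : at (state (suc t1)) (suc p) ≡ fU 2
      hd = segU 1 ≤-refl (s≤s z≤n) (suc t1) (subst (_< suc t1) (sym gU1) ≤-refl)
             (subst (λ z → suc z ≤ gU 2) gU1 (incU 1 ≤-refl (s≤s z≤n)))

  sum-bound : ∀ a b → 2 + a ≤ K → 2 + b ≤ K → a + b + 2 < K + K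
  sum-bound a b ha hb = ≤-trans (≤-trans (n≤1+n _) (≤-reflexive (sym eq))) (+-mono-≤ ha hb)
    where eq : (2 + a) + (2 + b) ≡ suc (suc (a + b + 2))
          eq = solve 2 (λ a b → (con 2 :+ a) :+ (con 2 :+ b) := con 2 :+ (a :+ b :+ con 2)) refl a b

  -- Where the walks meet, the next line of one walk is the last line of the other; as
  -- the lines of the cycle are distinct, together they go around it exactly once.
  meet-backward⇒a+b+2≡K : ∀ a b → fB (3 + a) ≡ fF (2 + b) → 2 + a ≤ K → 2 + b ≤ K → a + b + 2 ≡ K
  meet-backward⇒a+b+2≡K a b eq ha hb = [m+e]%n≡m%n⇒e≡n u (a + b + 2) K
      (trans (cong (_% K) eqn) (trans ([m+kn]%n≡m%n v (2 + a) K) (sym (hDist u v eq))))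
      (subst (0 <_) (+-comm 2 (a + b)) (s≤s z≤n))
      (sum-bound a b ha hb)
    where
    u = c1 + K' * (3 + a)
    v = c0 + (2 + b)
    eqn : u + (a + b + 2) ≡ v + (2 + a) * K
    eqn = solve 4 (λ s k a b → s :+ con 2 :+ (con 2 :+ k) :* (con 3 :+ a) :+ (a :+ b :+ con 2) := s :+ (con 2 :+ k) :+ (con 2 :+ b) :+ (con 2 :+ a) :* (con 3 :+ k)) refl s K'' a b

  meet-forward⇒a+b+2≡K : ∀ a b → fF (3 + a) ≡ fB (2 + b) → 2 + a ≤ K → 2 + b ≤ K → a + b + 2 ≡ K
  meet-forward⇒a+b+2≡K a b eq ha hb = [m+e]%n≡m%n⇒e≡n v (a + b + 2) K
      (trans (cong (_% K) eqn) (trans ([m+kn]%n≡m%n u (1 + b) K) (hDist u v eq)))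
      (subst (0 <_) (+-comm 2 (a + b)) (s≤s z≤n))
      (sum-bound a b ha hb)
    where
    u = c0 + (3 + a)
    v = c1 + K' * (2 + b)
    eqn : v + (a + b + 2) ≡ u + (1 + b) * K
    eqn = solve 4 (λ s k a b → s :+ con 2 :+ (con 2 :+ k) :* (con 2 :+ b) :+ (a :+ b :+ con 2) := s :+ (con 2 :+ k) :+ (con 3 :+ a) :+ (con 1 :+ b) :* (con 3 :+ k)) refl s K'' a b

  boundary-at : ∀ a b → a + b + 2 ≡ K → ∀ j → j < K →
    at (map fF (range 2 (suc a)) ++ reverse (map fB (range 2 (suc b)))) j ≡ I (s + 1 + j)
  boundary-at a b hab j hj with j <? suc a
  ... | yes lt = begin
      at (Lf ++ reverse Lb) j ≡⟨ at-++ˡ Lf (reverse Lb) j (subst (j <_) (sym lenF) lt) ⟩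
      at Lf j ≡⟨ at-map fF (range 2 (suc a)) j (subst (j <_) (sym (length-range 2 (suc a))) lt) ⟩
      fF (at (range 2 (suc a)) j) ≡⟨ cong fF (at-range 2 (suc a) j lt) ⟩
      fF (2 + j) ≡⟨ I-≡ _ _ 1 (solve 3 (λ s k j → s :+ (con 2 :+ k) :+ (con 2 :+ j) := s :+ con 1 :+ j :+ con 1 :* (con 3 :+ k)) refl s K'' j) ⟩
      I (s + 1 + j) ∎
    where
    Lf = map fF (range 2 (suc a))
    Lb = map fB (range 2 (suc b))
    lenF : length Lf ≡ suc a
    lenF = trans (length-map fF (range 2 (suc a))) (length-range 2 (suc a))
  ... | no ge = begin
      at (Lf ++ reverse Lb) j ≡⟨ cong (at (Lf ++ reverse Lb)) ej ⟩
      at (Lf ++ reverse Lb) (length Lf + m) ≡⟨ at-++ʳ Lf (reverse Lb) m ⟩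
      at (reverse Lb) m ≡⟨ at-reverse Lb m (subst (m <_) (sym lenB) m<b) ⟩
      at Lb (length Lb ∸ suc m) ≡⟨ cong (λ z → at Lb (z ∸ suc m)) lenB ⟩
      at Lb (b ∸ m) ≡⟨ at-map fB (range 2 (suc b)) (b ∸ m) (subst (b ∸ m <_) (sym (length-range 2 (suc b))) (s≤s (m∸n≤m b m))) ⟩
      fB (at (range 2 (suc b)) (b ∸ m)) ≡⟨ cong fB (at-range 2 (suc b) (b ∸ m) (s≤s (m∸n≤m b m))) ⟩
      fB (2 + r) ≡⟨ I-≡ _ _ (1 + r) eqn ⟩
      I (s + 1 + j) ∎
    where
    Lf = map fF (range 2 (suc a))
    Lb = map fB (range 2 (suc b))
    lenF : length Lf ≡ suc a
    lenF = trans (length-map fF (range 2 (suc a))) (length-range 2 (suc a))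
    lenB : length Lb ≡ suc b
    lenB = trans (length-map fB (range 2 (suc b))) (length-range 2 (suc b))
    m = j ∸ suc a
    ej' : suc a + m ≡ j
    ej' = m+[n∸m]≡n (≮⇒≥ ge)
    ej : j ≡ length Lf + m
    ej = trans (sym ej') (cong (_+ m) (sym lenF))
    m<b : m < suc b
    m<b = +-cancelˡ-< (suc a) m (suc b) (subst₂ _<_ (sym ej') (trans (sym hab) (solve 2 (λ a b → a :+ b :+ con 2 := con 1 :+ a :+ (con 1 :+ b)) refl a b)) hj)
    r = b ∸ m
    er : m + r ≡ b
    er = m+[n∸m]≡n (≤-pred m<b)
    H : a + (m + r) + 2 ≡ K
    H = trans (cong (λ z → a + z + 2) er) hab
    eqn : c1 + K' * (2 + r) ≡ (s + 1 + j) + (1 + r) * K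
    eqn = +-cancelʳ-≡ (2 + r) _ _ (begin
      c1 + K' * (2 + r) + (2 + r) ≡⟨ solve 3 (λ s k r → s :+ con 2 :+ (con 2 :+ k) :* (con 2 :+ r) :+ (con 2 :+ r) := s :+ con 2 :+ (con 2 :+ r) :* (con 3 :+ k)) refl s K'' r ⟩
      s + 2 + (2 + r) * K ≡⟨ solve 3 (λ s k r → s :+ con 2 :+ (con 2 :+ r) :* (con 3 :+ k) := s :+ con 2 :+ (con 1 :+ r) :* (con 3 :+ k) :+ (con 3 :+ k)) refl s K'' r ⟩
      s + 2 + (1 + r) * K + K ≡⟨ cong (λ z → s + 2 + (1 + r) * K + z) (sym H) ⟩
      s + 2 + (1 + r) * K + (a + (m + r) + 2) ≡⟨ solve 5 (λ s k r a m → s :+ con 2 :+ (con 1 :+ r) :* (con 3 :+ k) :+ (a :+ (m :+ r) :+ con 2) := s :+ con 1 :+ (con 1 :+ a :+ m) :+ (con 1 :+ r) :* (con 3 :+ k) :+ (con 2 :+ r)) refl s K'' r a m ⟩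
      s + 1 + (suc a + m) + (1 + r) * K + (2 + r) ≡⟨ cong (λ z → s + 1 + z + (1 + r) * K + (2 + r)) ej' ⟩
      s + 1 + j + (1 + r) * K + (2 + r) ∎)

  s<K : s < K
  s<K = sMin<K

  rotate-onto-is : ∀ C → length C ≡ K → (∀ j → j < K → at C j ≡ I (s + 1 + j)) → rotate (length (drop (suc s) is)) C ≡ is
  rotate-onto-is C hC hat = trans (cong (rotate (length (drop (suc s) is))) C≡) (rotate-inverse is (suc s))
    where
    C≡ : C ≡ rotate (suc s) is
    C≡ = at-ext C (rotate (suc s) is) (trans hC (sym (trans (length-rotate is (suc s)) hLen))) λ j hj →
      let j<K = subst (j <_) hC hj in
      trans (hat j j<K) (trans (cong (λ z → I (z + j)) (+-comm s 1)) (sym (at-rotate is K' (suc s) hLen s<K j j<K)))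

  K3 : 3 ≤ K
  K3 = s≤s (s≤s (s≤s z≤n))

  fF1 : fF 1 ≡ I s
  fF1 = I-≡ _ s 1 (solve 2 (λ s k → s :+ (con 2 :+ k) :+ con 1 := s :+ con 1 :* (con 3 :+ k)) refl s K'')
  fF2 : fF 2 ≡ I (1 + s)
  fF2 = I-≡ _ (1 + s) 1 (solve 2 (λ s k → s :+ (con 2 :+ k) :+ con 2 := con 1 :+ s :+ con 1 :* (con 3 :+ k)) refl s K'')
  fB1 : fB 1 ≡ I (1 + s)
  fB1 = I-≡ _ (1 + s) 1 (solve 2 (λ s k → s :+ con 2 :+ (con 2 :+ k) :* con 1 := con 1 :+ s :+ con 1 :* (con 3 :+ k)) refl s K'')
  fB2 : fB 2 ≡ I s
  fB2 = I-≡ _ s 2 (solve 2 (λ s k → s :+ con 2 :+ (con 2 :+ k) :* con 2 := s :+ con 2 :* (con 3 :+ k)) refl s K'')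

  length-boundary : ∀ a b → a + b + 2 ≡ K → length (map fF (range 2 (suc a)) ++ reverse (map fB (range 2 (suc b)))) ≡ K
  length-boundary a b h = trans (length-++ (map fF (range 2 (suc a))))
    (trans (cong₂ _+_ (trans (length-map fF (range 2 (suc a))) (length-range 2 (suc a)))
                      (trans (length-reverse (map fB (range 2 (suc b)))) (trans (length-map fB (range 2 (suc b))) (length-range 2 (suc b)))))
       (trans (solve 2 (λ a b → con 1 :+ a :+ (con 1 :+ b) := a :+ b :+ con 2) refl a b) h))

  bounds-lower-upper : at (state t1) p ≡ I s → at (state t1) (suc p) ≡ I (1 + s) → BoundsFace n w is
  bounds-lower-upper e1 e2 = t1 , t2 , face , length (drop (suc s) is) , inj₁ (trans (cong (rotate (length (drop (suc s) is))) beq) (rotate-onto-is _ (length-boundary a b hab) (boundary-at a b hab)))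
    where
    module LA = LowerWalk K K3 fF gF p t1 hVF hSF hDF hMinF hPerF hSideFL gF1 refl (trans e1 (sym fF1)) (trans e2 (sym fF2))
    module UA = UpperWalk K K3 fB gB p t1 hVB hSB hDB hMinB hPerB hSideBU gB1 refl (trans e2 (sym fB1)) (trans e1 (sym fB2))
    a = proj₁ LA.result
    SL = proj₁ (proj₂ LA.result)
    b = proj₁ UA.result
    SU = proj₁ (proj₂ UA.result)
    open Meet fF gF fB gB a b (hVF (2 + a) (≤-trans (LA.State.bnd SL) (n≤1+n K))) hSF hSB gF1 gB1
      (LA.State.bnd SL) (LA.State.inc SL) (LA.State.seg SL) (LA.State.low SL) (LA.State.first SL) (LA.State.noP SL) (proj₂ (proj₂ LA.result))
      (UA.State.bnd SU) (UA.State.inc SU) (UA.State.seg SU) (UA.State.low SU) (UA.State.first SU) (UA.State.noP SU) (proj₂ (proj₂ UA.result))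
    hab : a + b + 2 ≡ K
    hab = meet-forward⇒a+b+2≡K a b meet (LA.State.bnd SL) (UA.State.bnd SU)
    beq : boundary n w t1 t2 ≡ map fF (range 2 (suc a)) ++ reverse (map fB (range 2 (suc b)))
    beq = cong₂ (λ z1 z2 → z1 ++ reverse z2) lowerEq upperEq

  bounds-upper-lower : at (state t1) p ≡ I (1 + s) → at (state t1) (suc p) ≡ I s → BoundsFace n w is
  bounds-upper-lower e1 e2 = t1 , t2 , face , length (drop (suc s) is) , inj₂ (trans (cong (rotate (length (drop (suc s) is))) beq) (rotate-onto-is _ (length-boundary b a hab) (boundary-at b a hab)))
    where
    module LB = LowerWalk K K3 fB gB p t1 hVB hSB hDB hMinB hPerB hSideBL gB1 refl (trans e1 (sym fB1)) (trans e2 (sym fB2))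
    module UB = UpperWalk K K3 fF gF p t1 hVF hSF hDF hMinF hPerF hSideFU gF1 refl (trans e2 (sym fF1)) (trans e1 (sym fF2))
    a = proj₁ LB.result
    SL = proj₁ (proj₂ LB.result)
    b = proj₁ UB.result
    SU = proj₁ (proj₂ UB.result)
    open Meet fB gB fF gF a b (hVB (2 + a) (≤-trans (LB.State.bnd SL) (n≤1+n K))) hSB hSF gB1 gF1
      (LB.State.bnd SL) (LB.State.inc SL) (LB.State.seg SL) (LB.State.low SL) (LB.State.first SL) (LB.State.noP SL) (proj₂ (proj₂ LB.result))
      (UB.State.bnd SU) (UB.State.inc SU) (UB.State.seg SU) (UB.State.low SU) (UB.State.first SU) (UB.State.noP SU) (proj₂ (proj₂ UB.result))
    hab : b + a + 2 ≡ K
    hab = trans (cong (_+ 2) (+-comm b a)) (meet-backward⇒a+b+2≡K a b meet (LB.State.bnd SL) (UB.State.bnd SU))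
    beq : reverse (boundary n w t1 t2) ≡ map fF (range 2 (suc b)) ++ reverse (map fB (range 2 (suc a)))
    beq = begin
      reverse (lowerChain n w t1 t2 ++ reverse (upperChain n w t1 t2)) ≡⟨ reverse-++ (lowerChain n w t1 t2) _ ⟩
      reverse (reverse (upperChain n w t1 t2)) ++ reverse (lowerChain n w t1 t2) ≡⟨ cong (_++ reverse (lowerChain n w t1 t2)) (reverse-involutive _) ⟩
      upperChain n w t1 t2 ++ reverse (lowerChain n w t1 t2) ≡⟨ cong₂ (λ z1 z2 → z1 ++ reverse z2) upperEq lowerEq ⟩
      map fF (range 2 (suc b)) ++ reverse (map fB (range 2 (suc a))) ∎

  bounds : BoundsFace n w is
  bounds with θ-cross s
  ... | lower-upper e1 e2 = bounds-lower-upper e1 e2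
  ... | upper-lower e1 e2 = bounds-upper-lower e1 e2

module _ (n : ℕ) (w : List ℕ) (hw : All (λ p → suc p < n) w)
         (hc : ∀ i j → i < n → j < n → i ≢ j → count (isPair i j) (crossings n w) ≡ 1) where
  open CyclicTriples (AdjacentTriple n w)
  open Rows n w hw hc using (¬adjacentIn-self)

  boundsFace⇒adjacentTriples : ∀ is → BoundsFace n w is → All (AdjacentTriple n w) (cyclicTriples is)
  boundsFace⇒adjacentTriples _ (t1 , t2 , face , r , inj₁ refl) =
    cyclicTriples-rotate _ r (FaceBoundary.boundary-adjacentTriples n w hw hc t1 t2 face)
  boundsFace⇒adjacentTriples _ (t1 , t2 , face , r , inj₂ refl) =
    cyclicTriples-rotate _ r (cyclicTriples-reverse (adjacentTriple-flip n w) _ (FaceBoundary.boundary-adjacentTriples n w hw hc t1 t2 face))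

  adjacentTriples⇒boundsFace : ∀ is → All (_< n) is → Unique is → 1 ≤ length is →
    All (AdjacentTriple n w) (cyclicTriples is) → BoundsFace n w is
  adjacentTriples⇒boundsFace (x ∷ []) _ _ _ h = ⊥-elim (¬adjacentIn-self x x (cyclicTriples⇒periodic x [] h 0))
  adjacentTriples⇒boundsFace (x ∷ y ∷ []) _ _ _ h = ⊥-elim (¬adjacentIn-self y x (cyclicTriples⇒periodic x (y ∷ []) h 0))
  adjacentTriples⇒boundsFace is@(x ∷ y ∷ z ∷ xs) <n uniq _ h =
    FaceFromCycle.bounds n w hw hc is (length xs)
      (λ u v eq → unique-at is (u % K) (v % K) uniq (m%n<n u K) (m%n<n v K) eq)
      (λ j → All-at is (j % K) <n (m%n<n j K))
      (cyclicTriples⇒periodic x (y ∷ z ∷ xs) h)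
      refl
    where K = 3 + length xs

lemma3p1 : (n : ℕ) (w : List ℕ) → IsArrangement n w →
    (is : List ℕ) → All (_< n) is → Unique is → 1 ≤ length is →
    BoundsFace n w is ⇔ All (λ { (a , b , c) → AdjacentIn (O n w b) a c }) (cyclicTriples is)
lemma3p1 n w (hw , hc) is <n uniq nonempty =
  mk⇔ (boundsFace⇒adjacentTriples n w hw hc is) (adjacentTriples⇒boundsFace n w hw hc is <n uniq nonempty)
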